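{- Let $n,m\ge 1$ be integers, let $\zeta_n=e^{2\pi\sqrt{ -1}/n}$, and for positive integers $s_1,\dots,s_m$ put $$\mathfrak Z_n(\zeta_n;;s_1,\dots,s_m)=\sum_{1\le i_1<i_2<\dots<i_m\le n-1}\frac{1}{(1-\zeta_n^{i_1})^{s_1}(1-\zeta_n^{i_2})^{s_2}\cdots(1-\zeta_n^{i_m})^{s_m}}.$$ For a positive integer $A$ and $1\le j\le m$ write $\mathfrak Z_n(\zeta_n;;1^{j-1},A,1^{m-j})$ for $\mathfrak Z_n(\zeta_n;;s_1,\dots,s_m)$ with $s_j=A$ and $s_i=1$ for $i\neq j$. Then \begin{align*} \sum_{j=1}^{m}\mathfrak Z_n(\zeta_n;;1^{j-1},2,1^{m-j})&=-\frac{m(n-2 m-3)}{2(m+1)(m+2)}\binom{n-1}{m},\\ \sum_{j=1}^{m}\mathfrak Z_n(\zeta_n;;1^{j-1},3,1^{m-j})&=\frac{1}{m+1}\binom{n-1}{m}\left(-\frac{(n-1)(n-5)}{12}+\frac{(m+1)(n-2 m-5)(n-m-1)}{2(m+2)(m+3)}\right),\\ \sum_{j=1}^{m}\mathfrak Z_n(\zeta_n;;1^{j-1},4,1^{m-j})&=-\frac{(n-1)(n-3)}{8(m+1)}\binom{n-1}{m}+\frac{(n-1)(n-5)}{12(m+2)}\binom{n-1}{m+1}-\frac{(m+2)(n-2 m-7)}{2(m+3)(m+4)}\binom{n-1}{m+2},\\ \sum_{j=1}^{m}\mathfrak Z_n(\zeta_n;;1^{j-1},5,1^{m-j})&=\frac{(n-1)(n^3+n^2-109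 n+251)}{6!\,(m+1)}\binom{n-1}{m}+\frac{(n-1)(n-3)}{8(m+2)}\binom{n-1}{m+1}\\ &\quad -\frac{(n-1)(n-5)}{12(m+3)}\binom{n-1}{m+2}+\frac{(m+3)(n-2 m-9)}{2(m+4)(m+5)}\binom{n-1}{m+3}. \end{align*}
   Context: Binomial coefficients $\binom{a}{b}$ are zero when $b>a$ or $b<0$; an empty sum is $0$. -}

module Defs where

open import Level using (Level; _⊔_) renaming (suc to lsuc)
open import Algebra.Bundles using (CommutativeRing)
open import Data.Nat as ℕ using (ℕ; zero; suc; _∸_)
open import Data.Integer as ℤ using (ℤ; +_; -[1+_])
open import Data.List using (List; []; _∷_; _++_; replicate)
open import Data.Nat.Combinatorics using (_C_)
open import Relation.Nullary using (¬_)

-- A field: a commutative ring with 0 ≠ 1 in which every nonzero element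
-- has a multiplicative inverse (the inverse operation is total; its value
-- at 0 is irrelevant and never used below).
record Field (c ℓ : Level) : Set (lsuc (c ⊔ ℓ)) where
  field
    commutativeRing : CommutativeRing c ℓ
  open CommutativeRing commutativeRing public
  field
    _⁻¹        : Carrier → Carrier
    ⁻¹-inverse : ∀ x → ¬ (x ≈ 0#) → x * (x ⁻¹) ≈ 1#
    0≉1        : ¬ (0# ≈ 1#)

module FieldOps {c ℓ : Level} (F : Field c ℓ) where
  open Field F

  pow : Carrier → ℕ → Carrier
  pow x zero    = 1#
  pow x (suc k) = x * pow x k

  N : ℕ → Carrier
  N zero    = 0#
  N (suc k) = 1# + N k

  I : ℤ → Carrier
  I (+ k)      = N k
  I -[1+ k ]   = - N (suc k)

  -- a / d  for an integer a and a natural d (d will always be positive)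
  frac : ℤ → ℕ → Carrier
  frac a d = I a * (N d) ⁻¹

  CharZero : Set ℓ
  CharZero = ∀ k → ¬ (N (suc k) ≈ 0#)

  IsPrimitiveRoot : ℕ → Carrier → Set ℓ
  IsPrimitiveRoot n ζ = (pow ζ n ≈ 1#) × (∀ i → 1 ℕ.≤ i → i ℕ.< n → ¬ (pow ζ i ≈ 1#))
    where open import Data.Product using (_×_)

  sumFrom : ℕ → ℕ → (ℕ → Carrier) → Carrier
  sumFrom lo zero    f = 0#
  sumFrom lo (suc k) f = f lo + sumFrom (suc lo) k f

  -- Zrec n ζ lo (s₁ ∷ … ∷ sₖ) =
  --   Σ_{lo ≤ i₁ < i₂ < … < iₖ ≤ n-1}  Π_t 1/(1-ζ^{i_t})^{s_t}
  Zrec : ℕ → Carrier → ℕ → List ℕ → Carrier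
  Zrec n ζ lo []       = 1#
  Zrec n ζ lo (s ∷ ss) =
    sumFrom lo (n ∸ lo) (λ i → pow ((1# - pow ζ i) ⁻¹) s * Zrec n ζ (suc i) ss)

  𝔷 : ℕ → Carrier → List ℕ → Carrier
  𝔷 n ζ ss = Zrec n ζ 1 ss

  oneAt : ℕ → ℕ → ℕ → List ℕ
  oneAt m j A = replicate (j ∸ 1) 1 ++ (A ∷ replicate (m ∸ j) 1)

  S : ℕ → Carrier → ℕ → ℕ → Carrier
  S n ζ m A = sumFrom 1 m (λ j → 𝔷 n ζ (oneAt m j A))

  B : ℕ → ℕ → Carrier
  B n k = N ((n ∸ 1) C k)

{-# OPTIONS --safe #-}
module Submission where

-- Write xᵢ = 1/(1 - ζⁱ) for 1 ≤ i ≤ n - 1, and let eₖ and p_A be the elementary symmetric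
-- functions and the power sums of the xᵢ. Summing 𝔷ₙ(ζ; 1^{j-1}, A, 1^{m-j}) over j gives
-- S(A, m) = Σᵢ xᵢᴬ · eₘ₋₁(the other xⱼ), and splitting off one factor xᵢ yields
--   S(A+1, m) = p_A eₘ - S(A, m+1),   S(1, m) = m eₘ,   p_A = S(A, 1),
-- so each of the four formulas follows from the previous one (taken at 1 and at m + 1) once
-- the eₖ are known. For wᵢ = 1 - ζⁱ the twisted sums Σ_{i<n} wᵢᴬ ζ^{ij} vanish for
-- 1 ≤ j < n - A, so Σᵢ wᵢᴬ = n for 1 ≤ A ≤ n - 1; Newton's identities then force
-- eₖ(w) = C(n,k), and as xᵢ = 1/wᵢ, n eₖ = eₙ₋₁₋ₖ(w) = C(n,k+1), i.e. (k+1) eₖ = C(n-1,k).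
-- The rest is arithmetic of fractions with integer numerators.

open import Defs
open import Level using (Level)
open import Data.Nat as ℕ using (ℕ; _≤_)
open import Data.Integer as ℤ using (ℤ; +_)
open import Data.Product using (_×_)

module Binomial where
  open import Data.Nat
  open import Data.Nat.Properties
  open import Data.Nat.Combinatorics
  open import Relation.Binary.PropositionalEquality
  open import Relation.Nullary using (yes; no)
  open ≡-Reasoning

  [1+k]*[1+n]C[1+k]≡[1+n]*nCk : ∀ n k → suc k * (suc n C suc k) ≡ suc n * (n C k)
  [1+k]*[1+n]C[1+k]≡[1+n]*nCk zero zero = refl
  [1+k]*[1+n]C[1+k]≡[1+n]*nCk zero (suc k) = begin
    suc (suc k) * (1 C suc (suc k))   ≡⟨ cong (suc (suc k) *_) (k>n⇒nCk≡0 {1} {suc (suc k)} (s≤s (s≤s z≤n))) ⟩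
    suc (suc k) * 0                   ≡⟨ *-zeroʳ (suc (suc k)) ⟩
    0                                 ∎
  [1+k]*[1+n]C[1+k]≡[1+n]*nCk (suc n) zero = begin
    suc (suc n) C 1 + 0   ≡⟨ +-identityʳ _ ⟩
    suc (suc n) C 1       ≡⟨ nC1≡n (suc (suc n)) ⟩
    suc (suc n)           ≡⟨ *-identityʳ _ ⟨
    suc (suc n) * 1       ∎
  [1+k]*[1+n]C[1+k]≡[1+n]*nCk (suc n) (suc k) = begin
    suc (suc k) * (suc (suc n) C suc (suc k))   ≡⟨ cong (suc (suc k) *_) (nCk+nC[k+1]≡[n+1]C[k+1] (suc n) (suc k)) ⟨
    suc (suc k) * (X + Y)                       ≡⟨ *-distribˡ-+ (suc (suc k)) X Y ⟩
    (X + suc k * X) + suc (suc k) * Y           ≡⟨ cong₂ (λ u v → X + u + v) ([1+k]*[1+n]C[1+k]≡[1+n]*nCk n k)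
                                                                             ([1+k]*[1+n]C[1+k]≡[1+n]*nCk n (suc k)) ⟩
    (X + suc n * (n C k)) + suc n * (n C suc k) ≡⟨ +-assoc X _ _ ⟩
    X + (suc n * (n C k) + suc n * (n C suc k)) ≡⟨ cong (λ t → X + t) (*-distribˡ-+ (suc n) (n C k) (n C suc k)) ⟨
    X + suc n * (n C k + n C suc k)             ≡⟨ cong (λ t → X + suc n * t) (nCk+nC[k+1]≡[n+1]C[k+1] n k) ⟩
    suc (suc n) * X                             ∎
    where
    X Y : ℕ
    X = suc n C suc k
    Y = suc n C suc (suc k)

  [1+k]*nC[1+k]≡[n∸k]*nCk : ∀ n k → suc k * (n C suc k) ≡ (n ∸ k) * (n C k)
  [1+k]*nC[1+k]≡[n∸k]*nCk zero k = begin
    suc k * (0 C suc k)   ≡⟨ cong (suc k *_) (k>n⇒nCk≡0 {0} {suc k} (s≤s z≤n)) ⟩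
    suc k * 0             ≡⟨ *-zeroʳ (suc k) ⟩
    0                     ≡⟨ cong (_* (0 C k)) (0∸n≡0 k) ⟨
    (0 ∸ k) * (0 C k)     ∎
  [1+k]*nC[1+k]≡[n∸k]*nCk (suc n) zero = [1+k]*[1+n]C[1+k]≡[1+n]*nCk n zero
  [1+k]*nC[1+k]≡[n∸k]*nCk (suc n) (suc k) with k ≤? n
  ... | yes k≤n = begin
    suc (suc k) * (suc n C suc (suc k))   ≡⟨ [1+k]*[1+n]C[1+k]≡[1+n]*nCk n (suc k) ⟩
    suc n * b                             ≡⟨ cong (λ t → suc t * b) (m+[n∸m]≡n k≤n) ⟨
    (suc k + (n ∸ k)) * b                 ≡⟨ *-distribʳ-+ b (suc k) (n ∸ k) ⟩
    suc k * b + (n ∸ k) * b               ≡⟨ cong (_+ (n ∸ k) * b) ([1+k]*nC[1+k]≡[n∸k]*nCk n k) ⟩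
    (n ∸ k) * a + (n ∸ k) * b             ≡⟨ *-distribˡ-+ (n ∸ k) a b ⟨
    (n ∸ k) * (a + b)                     ≡⟨ cong ((n ∸ k) *_) (nCk+nC[k+1]≡[n+1]C[k+1] n k) ⟩
    (n ∸ k) * (suc n C suc k)             ∎
    where
    a b : ℕ
    a = n C k
    b = n C suc k
  ... | no k≰n = begin
    suc (suc k) * (suc n C suc (suc k))   ≡⟨ cong (suc (suc k) *_) (k>n⇒nCk≡0 (s≤s (m<n⇒m<1+n n<k))) ⟩
    suc (suc k) * 0                       ≡⟨ *-zeroʳ (suc (suc k)) ⟩
    0                                     ≡⟨ cong (_* (suc n C suc k)) (m≤n⇒m∸n≡0 (<⇒≤ n<k)) ⟨
    (n ∸ k) * (suc n C suc k)             ∎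
    where
    n<k : n < k
    n<k = ≰⇒> k≰n

module _ {ℓ₁ ℓ₂ : Level} (F : Field ℓ₁ ℓ₂) where
  open Field F hiding (zero)
  open FieldOps F
  open Binomial
  open import Data.Nat using (zero; suc; _∸_; z≤n; s≤s)
  import Data.Nat.Properties as ℕP
  open import Data.Nat.Combinatorics using (_C_; nC1≡n; nCk≡nC[n∸k]; k>n⇒nCk≡0)
  open import Data.Integer using (-[1+_])
  import Data.Integer.Properties as ℤP
  open import Data.Integer.Tactic.RingSolver using (solve-∀)
  open import Data.List using (List; []; _∷_; _++_; replicate; length; map; foldr)
  open import Data.List.Properties using (length-map)
  open import Data.List.Relation.Unary.All using (All; []; _∷_)
  open import Data.Maybe using (Maybe)
  import Data.Maybe as Maybe
  open import Data.Product using (proj₁; proj₂)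
  open import Function using (_∘_)
  open import Relation.Nullary using (yes; no)
  open import Relation.Nullary.Decidable using (dec⇒maybe)
  open import Relation.Binary.PropositionalEquality as P using (_≡_)
  open import Relation.Binary.Reasoning.Setoid setoid
  open import Algebra.Bundles using (Semiring)
  open import Algebra.Definitions.RawSemiring (Semiring.rawSemiring semiring) using (_^_)
  import Algebra.Definitions.RawMonoid +-rawMonoid as Additive
  open import Algebra.Properties.Monoid.Mult +-monoid using (×-homo-+)
  open import Algebra.Properties.Semiring.Mult semiring using (×1-homo-*)
  open import Algebra.Properties.Semiring.Exp semiring using (^-assocʳ)
  open import Algebra.Properties.Ring ring
    using (-‿distribˡ-*; -‿distribʳ-*; -‿involutive; -0#≈0#; -‿+-comm; [y-z]x≈yx-zx)
  open import Algebra.Properties.AbelianGroup +-abelianGroup using (xyx⁻¹≈y)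
  open import Algebra.Properties.Group +-group
    using (x≈z//y) renaming (x∙y⁻¹≈ε⇒x≈y to x-y≈0⇒x≈y; ∙-cancelˡ to +-cancelˡ)
  open import Algebra.Properties.CommutativeSemigroup *-commutativeSemigroup
    using (x∙yz≈y∙xz; x∙yz≈yx∙z; x∙yz≈xz∙y; xy∙z≈xz∙y; interchange)
  open import Algebra.Properties.CommutativeSemigroup +-commutativeSemigroup
    using () renaming (interchange to +-interchange)
  open import Algebra.Properties.CommutativeSemigroup ℕP.*-commutativeSemigroup
    using () renaming (xy∙z≈xz∙y to ℕ-xy*z≡xz*y)

  N≡×1 : ∀ k → N k ≡ k Additive.× 1#
  N≡×1 zero    = P.refl
  N≡×1 (suc k) = P.cong (λ x → 1# + x) (N≡×1 k)

  N-+ : ∀ a b → N (a ℕ.+ b) ≈ N a + N b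
  N-+ a b rewrite N≡×1 (a ℕ.+ b) | N≡×1 a | N≡×1 b = ×-homo-+ 1# a b

  N-* : ∀ a b → N (a ℕ.* b) ≈ N a * N b
  N-* a b rewrite N≡×1 (a ℕ.* b) | N≡×1 a | N≡×1 b = ×1-homo-* a b

  I-neg : ∀ a → I (ℤ.- a) ≈ - I a
  I-neg (+ zero)  = sym -0#≈0#
  I-neg (+ suc k) = refl
  I-neg -[1+ k ]  = sym (-‿involutive _)

  I-⊖ : ∀ a b → I (a ℤ.⊖ b) ≈ N a - N b
  I-⊖ a zero = begin
    I (a ℤ.⊖ 0)   ≡⟨ P.cong I (ℤP.⊖-≥ {a} {0} z≤n) ⟩
    N a           ≈⟨ +-identityʳ (N a) ⟨
    N a + 0#      ≈⟨ +-congˡ -0#≈0# ⟨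
    N a - 0#      ∎
  I-⊖ zero (suc b) = begin
    I (0 ℤ.⊖ suc b)   ≡⟨ P.cong I (ℤP.⊖-< {0} {suc b} (s≤s z≤n)) ⟩
    - N (suc b)       ≈⟨ +-identityˡ _ ⟨
    0# - N (suc b)    ∎
  I-⊖ (suc a) (suc b) = begin
    I (suc a ℤ.⊖ suc b)       ≡⟨ P.cong I (ℤP.[1+m]⊖[1+n]≡m⊖n a b) ⟩
    I (a ℤ.⊖ b)               ≈⟨ I-⊖ a b ⟩
    N a - N b                 ≈⟨ +-congʳ (xyx⁻¹≈y 1# (N a)) ⟨
    1# + N a - 1# - N b       ≈⟨ +-assoc _ _ _ ⟩
    1# + N a + (- 1# - N b)   ≈⟨ +-congˡ (-‿+-comm 1# (N b)) ⟩
    N (suc a) - N (suc b)     ∎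

  N-∸ : ∀ {a b} → b ≤ a → N (a ∸ b) ≈ N a - N b
  N-∸ {a} {b} b≤a = trans (reflexive (P.cong I (P.sym (ℤP.⊖-≥ b≤a)))) (I-⊖ a b)

  I-+ : ∀ a b → I (a ℤ.+ b) ≈ I a + I b
  I-+ (+ a)    (+ b)    = N-+ a b
  I-+ (+ a)    -[1+ b ] = I-⊖ a (suc b)
  I-+ -[1+ a ] (+ b)    = trans (I-⊖ b (suc a)) (+-comm _ _)
  I-+ -[1+ a ] -[1+ b ] = begin
    - N (suc (suc (a ℕ.+ b)))   ≡⟨ P.cong (λ k → - N k) (ℕP.+-suc (suc a) b) ⟨
    - N (suc a ℕ.+ suc b)       ≈⟨ -‿cong (N-+ (suc a) (suc b)) ⟩
    - (N (suc a) + N (suc b))   ≈⟨ -‿+-comm _ _ ⟨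
    - N (suc a) - N (suc b)     ∎

  I-- : ∀ a b → I (a ℤ.- b) ≈ I a - I b
  I-- a b = trans (I-+ a (ℤ.- b)) (+-congˡ (I-neg b))

  I-* : ∀ a b → I (a ℤ.* b) ≈ I a * I b
  I-* (+ a)     (+ b)     = trans (reflexive (P.cong I (P.sym (ℤP.pos-* a b)))) (N-* a b)
  I-* (+ zero)  -[1+ b ]  = sym (zeroˡ _)
  I-* (+ suc a) -[1+ b ]  = trans (-‿cong (N-* (suc a) (suc b))) (-‿distribʳ-* _ _)
  I-* -[1+ a ]  (+ b)     = begin
    I (-[1+ a ] ℤ.* + b)        ≡⟨ P.cong I (ℤP.neg-distribˡ-* (+ suc a) (+ b)) ⟨
    I (ℤ.- (+ suc a ℤ.* + b))   ≈⟨ I-neg (+ suc a ℤ.* + b) ⟩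
    - I (+ suc a ℤ.* + b)       ≈⟨ -‿cong (I-* (+ suc a) (+ b)) ⟩
    - (N (suc a) * N b)         ≈⟨ -‿distribˡ-* _ _ ⟩
    - N (suc a) * N b           ∎
  I-* -[1+ a ]  -[1+ b ]  = begin
    N (suc a ℕ.* suc b)           ≈⟨ N-* (suc a) (suc b) ⟩
    N (suc a) * N (suc b)         ≈⟨ -‿involutive _ ⟨
    - - (N (suc a) * N (suc b))   ≈⟨ -‿cong (-‿distribˡ-* _ _) ⟩
    - (- N (suc a) * N (suc b))   ≈⟨ -‿distribʳ-* _ _ ⟩
    - N (suc a) * - N (suc b)     ∎

  pos-^ : ∀ a k → + (a ℕ.^ k) ≡ (+ a) ℤ.^ k
  pos-^ a zero    = P.refl
  pos-^ a (suc k) = P.trans (ℤP.pos-* a (a ℕ.^ k)) (P.cong (λ t → + a ℤ.* t) (pos-^ a k))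

  -- The ring solver reads integer constants through ⟦_⟧ rather than I: the two agree up
  -- to ≈, but ⟦ + 1 ⟧ is 1# on the nose, so goals containing 1# are matched.
  N₁ : ℕ → Carrier
  N₁ zero          = 0#
  N₁ (suc zero)    = 1#
  N₁ (suc (suc k)) = 1# + N₁ (suc k)

  ⟦_⟧ : ℤ → Carrier
  ⟦ + k ⟧      = N₁ k
  ⟦ -[1+ k ] ⟧ = - N₁ (suc k)

  N₁≈N : ∀ k → N₁ k ≈ N k
  N₁≈N zero          = refl
  N₁≈N (suc zero)    = sym (+-identityʳ 1#)
  N₁≈N (suc (suc k)) = +-congˡ (N₁≈N (suc k))

  ⟦⟧≈I : ∀ a → ⟦ a ⟧ ≈ I a
  ⟦⟧≈I (+ k)    = N₁≈N k
  ⟦⟧≈I -[1+ k ] = -‿cong (N₁≈N (suc k))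

  open import Algebra.Solver.Ring.AlmostCommutativeRing
    using (fromCommutativeRing; _-Raw-AlmostCommutative⟶_)

  ℤ⟶F : ℤ.+-*-rawRing -Raw-AlmostCommutative⟶ fromCommutativeRing commutativeRing
  ℤ⟶F = record
    { ⟦_⟧    = ⟦_⟧
    ; +-homo = λ a b → trans (⟦⟧≈I (a ℤ.+ b)) (trans (I-+ a b) (sym (+-cong (⟦⟧≈I a) (⟦⟧≈I b))))
    ; *-homo = λ a b → trans (⟦⟧≈I (a ℤ.* b)) (trans (I-* a b) (sym (*-cong (⟦⟧≈I a) (⟦⟧≈I b))))
    ; -‿homo = λ a → trans (⟦⟧≈I (ℤ.- a)) (trans (I-neg a) (sym (-‿cong (⟦⟧≈I a))))
    ; 0-homo = refl
    ; 1-homo = refl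
    }

  ⟦⟧-≟ : ∀ a b → Maybe (⟦ a ⟧ ≈ ⟦ b ⟧)
  ⟦⟧-≟ a b = Maybe.map (reflexive ∘ P.cong ⟦_⟧) (dec⇒maybe (a ℤ.≟ b))

  open import Algebra.Solver.Ring ℤ.+-*-rawRing (fromCommutativeRing commutativeRing) ℤ⟶F ⟦⟧-≟
    using (solve; _:=_; _:+_; _:*_; _:-_; :-_; con)

  I[a-k-1]≈N[a]-N[1+k] : ∀ a k → I (+ a ℤ.- + k ℤ.- + 1) ≈ N a - N (suc k)
  I[a-k-1]≈N[a]-N[1+k] a k = begin
    I (+ a ℤ.- + k ℤ.- + 1)       ≈⟨ I-- (+ a ℤ.- + k) (+ 1) ⟩
    I (+ a ℤ.- + k) - (1# + 0#)   ≈⟨ +-congʳ (I-- (+ a) (+ k)) ⟩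
    N a - N k - (1# + 0#)         ≈⟨ regroup (N a) (N k) ⟩
    N a - N (suc k)               ∎
    where
    regroup : ∀ a k → a - k - (1# + 0#) ≈ a - (1# + k)
    regroup = solve 2 (λ a k → a :- k :- (con (+ 1) :+ con (+ 0)) := a :- (con (+ 1) :+ k)) refl

  ⁻¹-inverseˡ : ∀ {x} → x ≉ 0# → x ⁻¹ * x ≈ 1#
  ⁻¹-inverseˡ {x} x≉0 = trans (*-comm _ _) (⁻¹-inverse x x≉0)

  *-cancelˡ : ∀ {x y z} → x ≉ 0# → x * y ≈ x * z → y ≈ z
  *-cancelˡ {x} {y} {z} x≉0 xy≈xz = begin
    y                ≈⟨ *-identityˡ y ⟨
    1# * y           ≈⟨ *-congʳ (⁻¹-inverseˡ x≉0) ⟨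
    x ⁻¹ * x * y     ≈⟨ *-assoc _ _ _ ⟩
    x ⁻¹ * (x * y)   ≈⟨ *-congˡ xy≈xz ⟩
    x ⁻¹ * (x * z)   ≈⟨ *-assoc _ _ _ ⟨
    x ⁻¹ * x * z     ≈⟨ *-congʳ (⁻¹-inverseˡ x≉0) ⟩
    1# * z           ≈⟨ *-identityˡ z ⟩
    z                ∎

  *-≉0 : ∀ {x y} → x ≉ 0# → y ≉ 0# → x * y ≉ 0#
  *-≉0 {x} x≉0 y≉0 xy≈0 = y≉0 (*-cancelˡ x≉0 (trans xy≈0 (sym (zeroʳ x))))

  N-*-≉0 : ∀ a b → N a ≉ 0# → N b ≉ 0# → N (a ℕ.* b) ≉ 0#
  N-*-≉0 a b a≉0 b≉0 = *-≉0 a≉0 b≉0 ∘ trans (sym (N-* a b))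

  frac-unique : ∀ a d {x} → N d ≉ 0# → N d * x ≈ I a → x ≈ frac a d
  frac-unique a d {x} d≉0 dx≈a = begin
    x                    ≈⟨ *-identityʳ x ⟨
    x * 1#               ≈⟨ *-congˡ (⁻¹-inverse (N d) d≉0) ⟨
    x * (N d * N d ⁻¹)   ≈⟨ x∙yz≈yx∙z x (N d) (N d ⁻¹) ⟩
    N d * x * N d ⁻¹     ≈⟨ *-congʳ dx≈a ⟩
    I a * N d ⁻¹         ∎

  N*frac≈I : ∀ a d → N d ≉ 0# → N d * frac a d ≈ I a
  N*frac≈I a d d≉0 = begin
    N d * (I a * N d ⁻¹)   ≈⟨ x∙yz≈y∙xz (N d) (I a) (N d ⁻¹) ⟩
    I a * (N d * N d ⁻¹)   ≈⟨ *-congˡ (⁻¹-inverse (N d) d≉0) ⟩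
    I a * 1#               ≈⟨ *-identityʳ (I a) ⟩
    I a                    ∎

  unit-frac*N≈1 : ∀ d → N d ≉ 0# → frac (+ 1) d * N d ≈ 1#
  unit-frac*N≈1 d d≉0 = trans (*-comm _ _) (trans (N*frac≈I (+ 1) d d≉0) (+-identityʳ 1#))

  frac-intro : ∀ a d {x y} → N d ≉ 0# → N d * x ≈ I a * y → x ≈ frac a d * y
  frac-intro a d {x} {y} d≉0 dx≈ay = *-cancelˡ d≉0 (begin
    N d * x                 ≈⟨ dx≈ay ⟩
    I a * y                 ≈⟨ *-congʳ (N*frac≈I a d d≉0) ⟨
    N d * frac a d * y      ≈⟨ *-assoc _ _ _ ⟩
    N d * (frac a d * y)    ∎)

  frac*I≈frac : ∀ a b d → frac a d * I b ≈ frac (a ℤ.* b) d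
  frac*I≈frac a b d = begin
    I a * N d ⁻¹ * I b     ≈⟨ xy∙z≈xz∙y (I a) (N d ⁻¹) (I b) ⟩
    I a * I b * N d ⁻¹     ≈⟨ *-congʳ (I-* a b) ⟨
    I (a ℤ.* b) * N d ⁻¹   ∎

  -frac≈frac : ∀ a d → - frac a d ≈ frac (ℤ.- a) d
  -frac≈frac a d = trans (-‿distribˡ-* (I a) (N d ⁻¹)) (*-congʳ (sym (I-neg a)))

  frac*frac≈frac : ∀ a b d k → N d ≉ 0# → N k ≉ 0# →
                   frac a d * frac b k ≈ frac (a ℤ.* b) (d ℕ.* k)
  frac*frac≈frac a b d k d≉0 k≉0 = frac-unique (a ℤ.* b) (d ℕ.* k) (N-*-≉0 d k d≉0 k≉0) (begin
    N (d ℕ.* k) * (frac a d * frac b k)   ≈⟨ *-congʳ (N-* d k) ⟩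
    N d * N k * (frac a d * frac b k)     ≈⟨ interchange (N d) (N k) (frac a d) (frac b k) ⟩
    N d * frac a d * (N k * frac b k)     ≈⟨ *-cong (N*frac≈I a d d≉0) (N*frac≈I b k k≉0) ⟩
    I a * I b                             ≈⟨ I-* a b ⟨
    I (a ℤ.* b)                           ∎)

  frac*N≈frac : ∀ a d k → N d ≉ 0# → N k ≉ 0# → frac a (d ℕ.* k) * N k ≈ frac a d
  frac*N≈frac a d k d≉0 k≉0 = frac-unique a d d≉0 (begin
    N d * (frac a (d ℕ.* k) * N k)   ≈⟨ x∙yz≈xz∙y (N d) (frac a (d ℕ.* k)) (N k) ⟩
    N d * N k * frac a (d ℕ.* k)     ≈⟨ *-congʳ (N-* d k) ⟨
    N (d ℕ.* k) * frac a (d ℕ.* k)   ≈⟨ N*frac≈I a (d ℕ.* k) (N-*-≉0 d k d≉0 k≉0) ⟩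
    I a                              ∎)

  frac+frac≈frac : ∀ a b d k → N d ≉ 0# → N k ≉ 0# →
                   frac a d + frac b k ≈ frac (a ℤ.* + k ℤ.+ b ℤ.* + d) (d ℕ.* k)
  frac+frac≈frac a b d k d≉0 k≉0 = frac-unique (a ℤ.* + k ℤ.+ b ℤ.* + d) (d ℕ.* k) (N-*-≉0 d k d≉0 k≉0) (begin
    N (d ℕ.* k) * (frac a d + frac b k)             ≈⟨ *-congʳ (N-* d k) ⟩
    N d * N k * (frac a d + frac b k)               ≈⟨ regroup (N d) (N k) (frac a d) (frac b k) ⟩
    N k * (N d * frac a d) + N d * (N k * frac b k) ≈⟨ +-cong (*-congˡ (N*frac≈I a d d≉0))
                                                               (*-congˡ (N*frac≈I b k k≉0)) ⟩
    N k * I a + N d * I b                           ≈⟨ +-cong (*-comm (N k) (I a)) (*-comm (N d) (I b)) ⟩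
    I a * N k + I b * N d                           ≈⟨ +-cong (I-* a (+ k)) (I-* b (+ d)) ⟨
    I (a ℤ.* + k) + I (b ℤ.* + d)                   ≈⟨ I-+ (a ℤ.* + k) (b ℤ.* + d) ⟨
    I (a ℤ.* + k ℤ.+ b ℤ.* + d)                     ∎)
    where
    regroup : ∀ x y u v → x * y * (u + v) ≈ y * (x * u) + x * (y * v)
    regroup = solve 4 (λ x y u v → x :* y :* (u :+ v) := y :* (x :* u) :+ x :* (y :* v)) refl

  frac-cross : ∀ a b d k → N d ≉ 0# → N k ≉ 0# → a ℤ.* + k ≡ b ℤ.* + d → frac a d ≈ frac b k
  frac-cross a b d k d≉0 k≉0 ak≡bd = begin
    frac a d                     ≈⟨ frac*N≈frac a d k d≉0 k≉0 ⟨
    frac a (d ℕ.* k) * N k       ≈⟨ frac*I≈frac a (+ k) (d ℕ.* k) ⟩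
    frac (a ℤ.* + k) (d ℕ.* k)   ≡⟨ P.cong₂ frac ak≡bd (ℕP.*-comm d k) ⟩
    frac (b ℤ.* + d) (k ℕ.* d)   ≈⟨ frac*I≈frac b (+ d) (k ℕ.* d) ⟨
    frac b (k ℕ.* d) * N d       ≈⟨ frac*N≈frac b k d k≉0 d≉0 ⟩
    frac b k                     ∎

  sumFrom-cong : ∀ lo k {f g : ℕ → Carrier} → (∀ i → f i ≈ g i) → sumFrom lo k f ≈ sumFrom lo k g
  sumFrom-cong lo zero    f≈g = refl
  sumFrom-cong lo (suc k) f≈g = +-cong (f≈g lo) (sumFrom-cong (suc lo) k f≈g)

  sumFrom-+ : ∀ lo k (f g : ℕ → Carrier) →
              sumFrom lo k (λ i → f i + g i) ≈ sumFrom lo k f + sumFrom lo k g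
  sumFrom-+ lo zero    f g = sym (+-identityˡ 0#)
  sumFrom-+ lo (suc k) f g = trans (+-congˡ (sumFrom-+ (suc lo) k f g)) (+-interchange _ _ _ _)

  sumFrom-*ˡ : ∀ lo k a (f : ℕ → Carrier) → sumFrom lo k (λ i → a * f i) ≈ a * sumFrom lo k f
  sumFrom-*ˡ lo zero    a f = sym (zeroʳ a)
  sumFrom-*ˡ lo (suc k) a f = trans (+-congˡ (sumFrom-*ˡ (suc lo) k a f)) (sym (distribˡ a _ _))

  sumFrom-neg : ∀ lo k (f : ℕ → Carrier) → sumFrom lo k (λ i → - f i) ≈ - sumFrom lo k f
  sumFrom-neg lo zero    f = sym -0#≈0#
  sumFrom-neg lo (suc k) f = trans (+-congˡ (sumFrom-neg (suc lo) k f)) (-‿+-comm _ _)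

  sumFrom-- : ∀ lo k (f g : ℕ → Carrier) →
              sumFrom lo k (λ i → f i - g i) ≈ sumFrom lo k f - sumFrom lo k g
  sumFrom-- lo k f g = trans (sumFrom-+ lo k f (λ i → - g i)) (+-congˡ (sumFrom-neg lo k g))

  sumFrom-zero : ∀ lo k {f : ℕ → Carrier} → (∀ i → f i ≈ 0#) → sumFrom lo k f ≈ 0#
  sumFrom-zero lo k {f} f≈0 = trans (sumFrom-cong lo k f≈0) (zeros lo k)
    where
    zeros : ∀ lo k → sumFrom lo k (λ _ → 0#) ≈ 0#
    zeros lo zero    = refl
    zeros lo (suc k) = trans (+-identityˡ _) (zeros (suc lo) k)

  sumFrom-one : ∀ lo k → sumFrom lo k (λ _ → 1#) ≈ N k
  sumFrom-one lo zero    = refl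
  sumFrom-one lo (suc k) = +-congˡ (sumFrom-one (suc lo) k)

  sumFrom-suc : ∀ lo k (f : ℕ → Carrier) → sumFrom (suc lo) k f ≡ sumFrom lo k (f ∘ suc)
  sumFrom-suc lo zero    f = P.refl
  sumFrom-suc lo (suc k) f = P.cong (λ s → f (suc lo) + s) (sumFrom-suc (suc lo) k f)

  pow≡^ : ∀ x k → pow x k ≡ x ^ k
  pow≡^ x zero    = P.refl
  pow≡^ x (suc k) = P.cong (λ y → x * y) (pow≡^ x k)

  pow-swap : ∀ x i j → pow (pow x i) j ≈ pow (pow x j) i
  pow-swap x i j = begin
    pow (pow x i) j   ≡⟨ P.trans (P.cong (λ y → pow y j) (pow≡^ x i)) (pow≡^ (x ^ i) j) ⟩
    (x ^ i) ^ j       ≈⟨ ^-assocʳ x i j ⟩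
    x ^ (i ℕ.* j)     ≡⟨ P.cong (x ^_) (ℕP.*-comm i j) ⟩
    x ^ (j ℕ.* i)     ≈⟨ ^-assocʳ x j i ⟨
    (x ^ j) ^ i       ≡⟨ P.trans (P.cong (λ y → pow y i) (pow≡^ x j)) (pow≡^ (x ^ j) i) ⟨
    pow (pow x j) i   ∎

  pow-congˡ : ∀ {x y} k → x ≈ y → pow x k ≈ pow y k
  pow-congˡ zero    x≈y = refl
  pow-congˡ (suc k) x≈y = *-cong x≈y (pow-congˡ k x≈y)

  pow-1# : ∀ k → pow 1# k ≈ 1#
  pow-1# zero    = refl
  pow-1# (suc k) = trans (*-identityˡ _) (pow-1# k)

  geometric-sum : ∀ y lo k → (1# - y) * sumFrom lo k (pow y) ≈ pow y lo - pow y (lo ℕ.+ k)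
  geometric-sum y lo zero = begin
    (1# - y) * 0#             ≈⟨ zeroʳ _ ⟩
    0#                        ≈⟨ -‿inverseʳ (pow y lo) ⟨
    pow y lo - pow y lo       ≡⟨ P.cong (λ j → pow y lo - pow y j) (ℕP.+-identityʳ lo) ⟨
    pow y lo - pow y (lo ℕ.+ 0) ∎
  geometric-sum y lo (suc k) = begin
    (1# - y) * (pow y lo + sumFrom (suc lo) k (pow y))             ≈⟨ distribˡ _ _ _ ⟩
    (1# - y) * pow y lo + (1# - y) * sumFrom (suc lo) k (pow y)     ≈⟨ +-congˡ (geometric-sum y (suc lo) k) ⟩
    (1# - y) * pow y lo + (y * pow y lo - pow y (suc lo ℕ.+ k))     ≈⟨ telescope y (pow y lo) (pow y (suc lo ℕ.+ k)) ⟩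
    pow y lo - pow y (suc lo ℕ.+ k)                                 ≡⟨ P.cong (λ j → pow y lo - pow y j) (ℕP.+-suc lo k) ⟨
    pow y lo - pow y (lo ℕ.+ suc k)                                 ∎
    where
    telescope : ∀ y a b → (1# - y) * a + (y * a - b) ≈ a - b
    telescope = solve 3 (λ y a b → (con (+ 1) :- y) :* a :+ (y :* a :- b) := a :- b) refl

  geometric-sum-root : ∀ y k → y ≉ 1# → pow y k ≈ 1# → sumFrom 0 k (pow y) ≈ 0#
  geometric-sum-root y k y≉1 yᵏ≈1 = *-cancelˡ 1-y≉0 (begin
    (1# - y) * sumFrom 0 k (pow y)   ≈⟨ geometric-sum y 0 k ⟩
    1# - pow y k                     ≈⟨ +-congˡ (-‿cong yᵏ≈1) ⟩
    1# - 1#                          ≈⟨ -‿inverseʳ 1# ⟩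
    0#                               ≈⟨ zeroʳ _ ⟨
    (1# - y) * 0#                    ∎)
    where
    1-y≉0 : 1# - y ≉ 0#
    1-y≉0 1-y≈0 = y≉1 (sym (x-y≈0⇒x≈y _ _ 1-y≈0))

  -- Symmetric functions of a list

  values : (ℕ → Carrier) → ℕ → ℕ → List Carrier
  values f lo zero    = []
  values f lo (suc k) = f lo ∷ values f (suc lo) k

  e : ℕ → List Carrier → Carrier
  e zero    xs       = 1#
  e (suc k) []       = 0#
  e (suc k) (x ∷ xs) = x * e k xs + e (suc k) xs

  p : ℕ → List Carrier → Carrier
  p A []       = 0#
  p A (x ∷ xs) = pow x A + p A xs

  p-values : ∀ A f lo k → p A (values f lo k) ≡ sumFrom lo k (λ i → pow (f i) A)
  p-values A f lo zero    = P.refl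
  p-values A f lo (suc k) = P.cong (λ s → pow (f lo) A + s) (p-values A f (suc lo) k)

  length-values : ∀ f lo k → length (values f lo k) ≡ k
  length-values f lo zero    = P.refl
  length-values f lo (suc k) = P.cong suc (length-values f (suc lo) k)

  map-values : ∀ g f lo k → map g (values f lo k) ≡ values (g ∘ f) lo k
  map-values g f lo zero    = P.refl
  map-values g f lo (suc k) = P.cong (g (f lo) ∷_) (map-values g f (suc lo) k)

  -- M A k xs = Σᵢ xᵢ ^ A · e k (xs without xᵢ)
  M : ℕ → ℕ → List Carrier → Carrier
  M A zero    xs       = p A xs
  M A (suc k) []       = 0#
  M A (suc k) (x ∷ xs) = pow x A * e (suc k) xs + x * M A k xs + M A (suc k) xs

  p-one≡e-one : ∀ xs → p 1 xs ≡ e 1 xs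
  p-one≡e-one []       = P.refl
  p-one≡e-one (x ∷ xs) = P.cong (λ s → x * 1# + s) (p-one≡e-one xs)

  M-one : ∀ k xs → M 1 k xs ≈ N (suc k) * e (suc k) xs
  M-one zero xs = begin
    p 1 xs              ≡⟨ p-one≡e-one xs ⟩
    e 1 xs              ≈⟨ *-identityˡ (e 1 xs) ⟨
    1# * e 1 xs         ≈⟨ *-congʳ (+-identityʳ 1#) ⟨
    N 1 * e 1 xs        ∎
  M-one (suc k) []       = sym (zeroʳ _)
  M-one (suc k) (x ∷ xs) = begin
    pow x 1 * e₁ + x * M 1 k xs + M 1 (suc k) xs    ≈⟨ +-cong (+-congˡ (*-congˡ (M-one k xs))) (M-one (suc k) xs) ⟩
    x * 1# * e₁ + x * (N (suc k) * e₁) + N (suc (suc k)) * e₂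
                                                    ≈⟨ collect x e₁ e₂ (N (suc k)) ⟩
    N (suc (suc k)) * (x * e₁ + e₂)                 ∎
    where
    e₁ e₂ : Carrier
    e₁ = e (suc k) xs
    e₂ = e (suc (suc k)) xs
    collect : ∀ x e₁ e₂ c → x * 1# * e₁ + x * (c * e₁) + (1# + c) * e₂ ≈ (1# + c) * (x * e₁ + e₂)
    collect = solve 4 (λ x e₁ e₂ c → x :* con (+ 1) :* e₁ :+ x :* (c :* e₁) :+ (con (+ 1) :+ c) :* e₂
                                    := (con (+ 1) :+ c) :* (x :* e₁ :+ e₂)) refl

  M-newton : ∀ A k xs → M (suc A) k xs + M A (suc k) xs ≈ p A xs * e (suc k) xs
  M-newton A zero    []       = trans (+-identityˡ 0#) (sym (zeroˡ 0#))
  M-newton A (suc k) []       = trans (+-identityˡ 0#) (sym (zeroˡ 0#))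
  M-newton A zero    (x ∷ xs) = begin
    (x * y + p (suc A) xs) + (y * e₁ + x * p A xs + M A 1 xs)
                                    ≈⟨ regroup x y (p (suc A) xs) e₁ (p A xs) (M A 1 xs) ⟩
    x * y + y * e₁ + x * p A xs + (p (suc A) xs + M A 1 xs)
                                    ≈⟨ +-congˡ (M-newton A zero xs) ⟩
    x * y + y * e₁ + x * p A xs + p A xs * e₁
                                    ≈⟨ factor x y e₁ (p A xs) ⟩
    (y + p A xs) * (x * 1# + e₁)    ∎
    where
    y e₁ : Carrier
    y  = pow x A
    e₁ = e 1 xs
    regroup : ∀ x y q e₁ r s → (x * y + q) + (y * e₁ + x * r + s) ≈ x * y + y * e₁ + x * r + (q + s)
    regroup = solve 6 (λ x y q e₁ r s → (x :* y :+ q) :+ (y :* e₁ :+ x :* r :+ s)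
                                       := x :* y :+ y :* e₁ :+ x :* r :+ (q :+ s)) refl
    factor : ∀ x y e₁ r → x * y + y * e₁ + x * r + r * e₁ ≈ (y + r) * (x * 1# + e₁)
    factor = solve 4 (λ x y e₁ r → x :* y :+ y :* e₁ :+ x :* r :+ r :* e₁
                                  := (y :+ r) :* (x :* con (+ 1) :+ e₁)) refl
  M-newton A (suc k) (x ∷ xs) = begin
    (x * y * e₁ + x * M (suc A) k xs + M (suc A) (suc k) xs) + (y * e₂ + x * M A (suc k) xs + M A (suc (suc k)) xs)
                                    ≈⟨ regroup x (x * y) y e₁ e₂ (M (suc A) k xs) (M A (suc k) xs)
                                               (M (suc A) (suc k) xs) (M A (suc (suc k)) xs) ⟩
    x * y * e₁ + y * e₂ + x * (M (suc A) k xs + M A (suc k) xs) + (M (suc A) (suc k) xs + M A (suc (suc k)) xs)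
                                    ≈⟨ +-cong (+-congˡ (*-congˡ (M-newton A k xs))) (M-newton A (suc k) xs) ⟩
    x * y * e₁ + y * e₂ + x * (p A xs * e₁) + p A xs * e₂
                                    ≈⟨ factor x y e₁ e₂ (p A xs) ⟩
    (y + p A xs) * (x * e₁ + e₂)    ∎
    where
    y e₁ e₂ : Carrier
    y  = pow x A
    e₁ = e (suc k) xs
    e₂ = e (suc (suc k)) xs
    regroup : ∀ x xy y e₁ e₂ u v u′ v′ → (xy * e₁ + x * u + u′) + (y * e₂ + x * v + v′)
                                         ≈ xy * e₁ + y * e₂ + x * (u + v) + (u′ + v′)
    regroup = solve 9 (λ x xy y e₁ e₂ u v u′ v′ → (xy :* e₁ :+ x :* u :+ u′) :+ (y :* e₂ :+ x :* v :+ v′)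
                                                 := xy :* e₁ :+ y :* e₂ :+ x :* (u :+ v) :+ (u′ :+ v′)) refl
    factor : ∀ x y e₁ e₂ r → x * y * e₁ + y * e₂ + x * (r * e₁) + r * e₂ ≈ (y + r) * (x * e₁ + e₂)
    factor = solve 5 (λ x y e₁ e₂ r → x :* y :* e₁ :+ y :* e₂ :+ x :* (r :* e₁) :+ r :* e₂
                                     := (y :+ r) :* (x :* e₁ :+ e₂)) refl

  e-over : ∀ k xs → length xs ℕ.< k → e k xs ≈ 0#
  e-over (suc k) []       _            = refl
  e-over (suc k) (x ∷ xs) (s≤s len≤k) = begin
    x * e k xs + e (suc k) xs   ≈⟨ +-cong (*-congˡ (e-over k xs len≤k)) (e-over (suc k) xs (ℕP.m<n⇒m<1+n len≤k)) ⟩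
    x * 0# + 0#                 ≈⟨ +-identityʳ _ ⟩
    x * 0#                      ≈⟨ zeroʳ x ⟩
    0#                          ∎

  e-reciprocal : ∀ ws → All (_≉ 0#) ws → ∀ k j → k ℕ.+ j ≡ length ws →
                 e k (map _⁻¹ ws) * foldr _*_ 1# ws ≈ e j ws
  e-reciprocal []       []            zero    zero    _  = *-identityˡ 1#
  e-reciprocal (w ∷ ws) (_ ∷ ws≉0)    zero    (suc j) eq = begin
    1# * (w * P)                ≈⟨ *-identityˡ _ ⟩
    w * P                       ≈⟨ *-congˡ (trans (sym (*-identityˡ P)) (e-reciprocal ws ws≉0 zero j j≡len)) ⟩
    w * e j ws                  ≈⟨ +-identityʳ _ ⟨
    w * e j ws + 0#             ≈⟨ +-congˡ (e-over (suc j) ws (ℕP.≤-reflexive (P.cong suc (P.sym j≡len)))) ⟨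
    w * e j ws + e (suc j) ws   ∎
    where
    P : Carrier
    P = foldr _*_ 1# ws
    j≡len : j ≡ length ws
    j≡len = ℕP.suc-injective eq
  e-reciprocal (w ∷ ws) (w≉0 ∷ ws≉0) (suc k) j eq = begin
    (w ⁻¹ * a + b) * (w * P)        ≈⟨ distribute w (w ⁻¹) a b P ⟩
    w * w ⁻¹ * (a * P) + w * (b * P) ≈⟨ +-congʳ (trans (*-congʳ (⁻¹-inverse w w≉0)) (*-identityˡ _)) ⟩
    a * P + w * (b * P)             ≈⟨ by-cases j (ℕP.suc-injective eq) ⟩
    e j (w ∷ ws)                    ∎
    where
    P a b : Carrier
    P = foldr _*_ 1# ws
    a = e k (map _⁻¹ ws)
    b = e (suc k) (map _⁻¹ ws)
    distribute : ∀ w i a b P → (i * a + b) * (w * P) ≈ w * i * (a * P) + w * (b * P)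
    distribute = solve 5 (λ w i a b P → (i :* a :+ b) :* (w :* P) := w :* i :* (a :* P) :+ w :* (b :* P)) refl
    by-cases : ∀ j → k ℕ.+ j ≡ length ws → a * P + w * (b * P) ≈ e j (w ∷ ws)
    by-cases zero k+0≡len = begin
      a * P + w * (b * P)   ≈⟨ +-cong (e-reciprocal ws ws≉0 k zero k+0≡len) (*-congˡ (trans (*-congʳ b≈0) (zeroˡ P))) ⟩
      1# + w * 0#           ≈⟨ +-congˡ (zeroʳ w) ⟩
      1# + 0#               ≈⟨ +-identityʳ 1# ⟩
      1#                    ∎
      where
      b≈0 : b ≈ 0#
      b≈0 = e-over (suc k) (map _⁻¹ ws)
              (s≤s (ℕP.≤-reflexive (P.trans (length-map _⁻¹ ws) (P.trans (P.sym k+0≡len) (ℕP.+-identityʳ k)))))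
    by-cases (suc j) k+1+j≡len = begin
      a * P + w * (b * P)         ≈⟨ +-cong (e-reciprocal ws ws≉0 k (suc j) k+1+j≡len)
                                            (*-congˡ (e-reciprocal ws ws≉0 (suc k) j (P.trans (P.sym (ℕP.+-suc k j)) k+1+j≡len))) ⟩
      e (suc j) ws + w * e j ws   ≈⟨ +-comm _ _ ⟩
      w * e j ws + e (suc j) ws   ∎

  module ConstantPowerSums (xs : List Carrier) (c : Carrier) (r : ℕ)
                           (p≈c : ∀ A → 1 ≤ A → A ≤ r → p A xs ≈ c) where

    M-shift : ∀ A k → 1 ≤ A → A ℕ.+ k ℕ.< r → M A k xs ≈ M (suc A) k xs
    M-shift A zero 1≤A A+0<r = trans (p≈c A 1≤A (ℕP.<⇒≤ A<r)) (sym (p≈c (suc A) (s≤s z≤n) A<r))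
      where
      A<r : A ℕ.< r
      A<r = ℕP.≤-trans (s≤s (ℕP.≤-reflexive (P.sym (ℕP.+-identityʳ A)))) A+0<r
    M-shift A (suc k) 1≤A A+1+k<r = +-cancelˡ (M (suc A) k xs) _ _ (begin
      M (suc A) k xs + M A (suc k) xs              ≈⟨ M-newton A k xs ⟩
      p A xs * e (suc k) xs                        ≈⟨ *-congʳ (trans (p≈c A 1≤A (ℕP.<⇒≤ A<r)) (sym (p≈c (suc A) (s≤s z≤n) A<r))) ⟩
      p (suc A) xs * e (suc k) xs                  ≈⟨ M-newton (suc A) k xs ⟨
      M (suc (suc A)) k xs + M (suc A) (suc k) xs  ≈⟨ +-congʳ (M-shift (suc A) k (s≤s z≤n) 1+A+k<r) ⟨
      M (suc A) k xs + M (suc A) (suc k) xs        ∎)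
      where
      1+A+k<r : suc A ℕ.+ k ℕ.< r
      1+A+k<r = ℕP.≤-trans (s≤s (ℕP.≤-reflexive (P.sym (ℕP.+-suc A k)))) A+1+k<r
      A<r : A ℕ.< r
      A<r = ℕP.≤-trans (ℕP.m≤n⇒m≤1+n (s≤s (ℕP.m≤m+n A k))) 1+A+k<r

    e-recurrence : ∀ k → suc (suc k) ≤ r →
                   N (suc (suc k)) * e (suc (suc k)) xs ≈ (c - N (suc k)) * e (suc k) xs
    e-recurrence k 2+k≤r = +-cancelˡ (N (suc k) * e₁) _ _ (begin
      N (suc k) * e₁ + N (suc (suc k)) * e (suc (suc k)) xs  ≈⟨ +-cong (M-one k xs) (M-one (suc k) xs) ⟨
      M 1 k xs + M 1 (suc k) xs                              ≈⟨ +-congʳ (M-shift 1 k (s≤s z≤n) 2+k≤r) ⟩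
      M 2 k xs + M 1 (suc k) xs                              ≈⟨ M-newton 1 k xs ⟩
      p 1 xs * e₁                                            ≈⟨ *-congʳ (p≈c 1 (s≤s z≤n) (ℕP.≤-trans (s≤s z≤n) 2+k≤r)) ⟩
      c * e₁                                                 ≈⟨ split c (N (suc k)) e₁ ⟩
      N (suc k) * e₁ + (c - N (suc k)) * e₁                  ∎)
      where
      e₁ : Carrier
      e₁ = e (suc k) xs
      split : ∀ c d e₁ → c * e₁ ≈ d * e₁ + (c - d) * e₁
      split = solve 3 (λ c d e₁ → c :* e₁ := d :* e₁ :+ (c :- d) :* e₁) refl

  -- 𝔷-sums as symmetric functions of the xᵢ = 1/(1 - ζⁱ)

  𝔷-list : List Carrier → List ℕ → Carrier
  𝔷-list xs       []       = 1#
  𝔷-list []       (s ∷ ss) = 0#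
  𝔷-list (x ∷ xs) (s ∷ ss) = pow x s * 𝔷-list xs ss + 𝔷-list xs (s ∷ ss)

  𝔷-list-ones : ∀ k xs → 𝔷-list xs (replicate k 1) ≈ e k xs
  𝔷-list-ones zero    xs       = refl
  𝔷-list-ones (suc k) []       = refl
  𝔷-list-ones (suc k) (x ∷ xs) = +-cong (*-cong (*-identityʳ x) (𝔷-list-ones k xs)) (𝔷-list-ones (suc k) xs)

  𝔷-list-oneAt : ∀ A K xs → sumFrom 0 (suc K) (λ a → 𝔷-list xs (oneAt (suc K) (suc a) A)) ≈ M A K xs
  𝔷-list-oneAt A zero    []       = +-identityˡ 0#
  𝔷-list-oneAt A (suc K) []       = sumFrom-zero 0 (suc (suc K)) vanish
    where
    vanish : ∀ a → 𝔷-list [] (oneAt (suc (suc K)) (suc a) A) ≈ 0#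
    vanish zero    = refl
    vanish (suc a) = refl
  𝔷-list-oneAt A zero    (x ∷ xs) = begin
    pow x A * 1# + 𝔷-list xs (A ∷ []) + 0#   ≈⟨ +-assoc _ _ _ ⟩
    pow x A * 1# + (𝔷-list xs (A ∷ []) + 0#) ≈⟨ +-cong (*-identityʳ _) (𝔷-list-oneAt A zero xs) ⟩
    pow x A + p A xs                        ∎
  𝔷-list-oneAt A (suc K) (x ∷ xs) = begin
    G (x ∷ xs) 0 (suc K) + sumFrom 1 (suc K) (λ a → G (x ∷ xs) a (suc K ∸ a))
      ≡⟨ P.cong (λ s → G (x ∷ xs) 0 (suc K) + s) (sumFrom-suc 0 (suc K) _) ⟩
    G (x ∷ xs) 0 (suc K) + sumFrom 0 (suc K) (λ a → pow x 1 * G xs a (K ∸ a) + G xs (suc a) (K ∸ a))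
      ≈⟨ +-congˡ (trans (sumFrom-+ 0 (suc K) _ _) (+-congʳ (sumFrom-*ˡ 0 (suc K) (pow x 1) _))) ⟩
    (pow x A * 𝔷-list xs (replicate (suc K) 1) + G xs 0 (suc K)) + (pow x 1 * Σ₁ + Σ₂)
      ≈⟨ regroup (pow x A * 𝔷-list xs (replicate (suc K) 1)) (G xs 0 (suc K)) (pow x 1 * Σ₁) Σ₂ ⟩
    pow x A * 𝔷-list xs (replicate (suc K) 1) + pow x 1 * Σ₁ + (G xs 0 (suc K) + Σ₂)
      ≡⟨ P.cong (λ s → pow x A * 𝔷-list xs (replicate (suc K) 1) + pow x 1 * Σ₁ + (G xs 0 (suc K) + s))
                (sumFrom-suc 0 (suc K) (λ a → G xs a (suc K ∸ a))) ⟨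
    pow x A * 𝔷-list xs (replicate (suc K) 1) + pow x 1 * Σ₁ + sumFrom 0 (suc (suc K)) (λ a → G xs a (suc K ∸ a))
      ≈⟨ +-cong (+-cong (*-congˡ (𝔷-list-ones (suc K) xs)) (*-cong (*-identityʳ x) (𝔷-list-oneAt A K xs)))
                (𝔷-list-oneAt A (suc K) xs) ⟩
    pow x A * e (suc K) xs + x * M A K xs + M A (suc K) xs
      ∎
    where
    G : List Carrier → ℕ → ℕ → Carrier
    G ys a b = 𝔷-list ys (replicate a 1 ++ A ∷ replicate b 1)
    Σ₁ Σ₂ : Carrier
    Σ₁ = sumFrom 0 (suc K) (λ a → G xs a (K ∸ a))
    Σ₂ = sumFrom 0 (suc K) (λ a → G xs (suc a) (K ∸ a))
    regroup : ∀ a b c d → (a + b) + (c + d) ≈ a + c + (b + d)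
    regroup = solve 4 (λ a b c d → (a :+ b) :+ (c :+ d) := a :+ c :+ (b :+ d)) refl

  Zrec-values : ∀ n ζ k lo → n ∸ lo ≡ k → ∀ ss →
                Zrec n ζ lo ss ≈ 𝔷-list (values (λ i → (1# - pow ζ i) ⁻¹) lo k) ss
  Zrec-values n ζ k       lo n∸lo≡k []       = refl
  Zrec-values n ζ zero    lo n∸lo≡0 (s ∷ ss) rewrite n∸lo≡0 = refl
  Zrec-values n ζ (suc k) lo n∸lo≡1+k (s ∷ ss) = begin
    sumFrom lo (n ∸ lo) term                      ≡⟨ P.cong (λ j → sumFrom lo j term) n∸lo≡1+k ⟩
    term lo + sumFrom (suc lo) k term             ≡⟨ P.cong (λ j → term lo + sumFrom (suc lo) j term) n∸1+lo≡k ⟨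
    term lo + Zrec n ζ (suc lo) (s ∷ ss)          ≈⟨ +-cong (*-congˡ (Zrec-values n ζ k (suc lo) n∸1+lo≡k ss))
                                                           (Zrec-values n ζ k (suc lo) n∸1+lo≡k (s ∷ ss)) ⟩
    𝔷-list (values x lo (suc k)) (s ∷ ss)         ∎
    where
    x : ℕ → Carrier
    x i = (1# - pow ζ i) ⁻¹
    term : ℕ → Carrier
    term i = pow (x i) s * Zrec n ζ (suc i) ss
    n∸1+lo≡k : n ∸ suc lo ≡ k
    n∸1+lo≡k = P.trans (P.sym (ℕP.pred[m∸n]≡m∸[1+n] n lo)) (P.cong ℕ.pred n∸lo≡1+k)

  module Reciprocals (n : ℕ) (ζ : Carrier) where

    xs : List Carrier
    xs = values (λ i → (1# - pow ζ i) ⁻¹) 1 (n ∸ 1)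

    S≈M : ∀ K A → S n ζ (suc K) A ≈ M A K xs
    S≈M K A = begin
      sumFrom 1 (suc K) (λ j → 𝔷 n ζ (oneAt (suc K) j A))         ≡⟨ sumFrom-suc 0 (suc K) _ ⟩
      sumFrom 0 (suc K) (λ a → 𝔷 n ζ (oneAt (suc K) (suc a) A))   ≈⟨ sumFrom-cong 0 (suc K)
                                                                         (λ a → Zrec-values n ζ (n ∸ 1) 1 P.refl (oneAt (suc K) (suc a) A)) ⟩
      sumFrom 0 (suc K) (λ a → 𝔷-list xs (oneAt (suc K) (suc a) A)) ≈⟨ 𝔷-list-oneAt A K xs ⟩
      M A K xs                                                    ∎

    S-one : ∀ K → S n ζ (suc K) 1 ≈ N (suc K) * e (suc K) xs
    S-one K = trans (S≈M K 1) (M-one K xs)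

    S-newton : ∀ K A → S n ζ (suc K) (suc A) ≈ S n ζ 1 A * e (suc K) xs - S n ζ (suc (suc K)) A
    S-newton K A = begin
      S n ζ (suc K) (suc A)                              ≈⟨ S≈M K (suc A) ⟩
      M (suc A) K xs                                     ≈⟨ x≈z//y _ _ _ (M-newton A K xs) ⟩
      p A xs * e (suc K) xs - M A (suc K) xs             ≈⟨ +-cong (*-congʳ (S≈M 0 A)) (-‿cong (S≈M (suc K) A)) ⟨
      S n ζ 1 A * e (suc K) xs - S n ζ (suc (suc K)) A   ∎

    S-closed-form-suc : ∀ A (R R′ : ℕ → Carrier) → (∀ K → S n ζ (suc K) A ≈ R (suc K)) →
                        (∀ m → R 1 * e m xs - R (suc m) ≈ R′ m) → ∀ K → S n ζ (suc K) (suc A) ≈ R′ (suc K)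
    S-closed-form-suc A R R′ S≈R step K = begin
      S n ζ (suc K) (suc A)                              ≈⟨ S-newton K A ⟩
      S n ζ 1 A * e (suc K) xs - S n ζ (suc (suc K)) A   ≈⟨ +-cong (*-congʳ (S≈R 0)) (-‿cong (S≈R (suc K))) ⟩
      R 1 * e (suc K) xs - R (suc (suc K))               ≈⟨ step (suc K) ⟩
      R′ (suc K)                                         ∎

  -- Roots of unity

  module RootsOfUnity (cz : CharZero) (n′ : ℕ) (ζ : Carrier) (prim : IsPrimitiveRoot (suc n′) ζ) where

    n : ℕ
    n = suc n′

    ν : Carrier
    ν = N n

    w : ℕ → Carrier
    w i = 1# - pow ζ i

    ws : List Carrier
    ws = values w 1 n′

    twisted : ℕ → ℕ → Carrier
    twisted A j = sumFrom 0 n (λ i → pow (w i) A * pow (pow ζ i) j)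

    twisted-zero : ∀ j → 1 ≤ j → j ℕ.< n → twisted 0 j ≈ 0#
    twisted-zero j 1≤j j<n = begin
      sumFrom 0 n (λ i → 1# * pow (pow ζ i) j)   ≈⟨ sumFrom-cong 0 n (λ i → trans (*-identityˡ _) (pow-swap ζ i j)) ⟩
      sumFrom 0 n (pow (pow ζ j))                ≈⟨ geometric-sum-root (pow ζ j) n (proj₂ prim j 1≤j j<n) ζʲⁿ≈1 ⟩
      0#                                         ∎
      where
      ζʲⁿ≈1 : pow (pow ζ j) n ≈ 1#
      ζʲⁿ≈1 = trans (pow-swap ζ j n) (trans (pow-congˡ j (proj₁ prim)) (pow-1# j))

    twisted-suc : ∀ A j → twisted (suc A) j ≈ twisted A j - twisted A (suc j)
    twisted-suc A j = trans (sumFrom-cong 0 n (λ i → split (pow ζ i) (pow (w i) A) (pow (pow ζ i) j)))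
                            (sumFrom-- 0 n _ _)
      where
      split : ∀ z a b → (1# - z) * a * b ≈ a * b - a * (z * b)
      split = solve 3 (λ z a b → (con (+ 1) :- z) :* a :* b := a :* b :- a :* (z :* b)) refl

    twisted-vanish : ∀ A j → 1 ≤ j → j ℕ.+ A ℕ.< n → twisted A j ≈ 0#
    twisted-vanish zero    j 1≤j j+0<n = twisted-zero j 1≤j (P.subst (ℕ._< n) (ℕP.+-identityʳ j) j+0<n)
    twisted-vanish (suc A) j 1≤j j+1+A<n = begin
      twisted (suc A) j                  ≈⟨ twisted-suc A j ⟩
      twisted A j - twisted A (suc j)    ≈⟨ +-cong (twisted-vanish A j 1≤j (ℕP.<⇒≤ 1+j+A<n))
                                                   (-‿cong (twisted-vanish A (suc j) (s≤s z≤n) 1+j+A<n)) ⟩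
      0# - 0#                            ≈⟨ -‿inverseʳ 0# ⟩
      0#                                 ∎
      where
      1+j+A<n : suc j ℕ.+ A ℕ.< n
      1+j+A<n = P.subst (ℕ._< n) (ℕP.+-suc j A) j+1+A<n

    twisted-at-zero : ∀ A → A ℕ.< n → twisted A 0 ≈ ν
    twisted-at-zero zero    _     = trans (sumFrom-cong 0 n (λ i → *-identityʳ 1#)) (sumFrom-one 0 n)
    twisted-at-zero (suc A) 1+A<n = begin
      twisted (suc A) 0              ≈⟨ twisted-suc A 0 ⟩
      twisted A 0 - twisted A 1      ≈⟨ +-cong (twisted-at-zero A (ℕP.<⇒≤ 1+A<n)) (-‿cong (twisted-vanish A 1 (s≤s z≤n) 1+A<n)) ⟩
      ν - 0#                         ≈⟨ +-congˡ -0#≈0# ⟩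
      ν + 0#                         ≈⟨ +-identityʳ ν ⟩
      ν                              ∎

    p-ws : ∀ A → 1 ≤ A → A ≤ n′ → p A ws ≈ ν
    p-ws (suc A) _ 1+A≤n′ = begin
      p (suc A) ws                                             ≡⟨ p-values (suc A) w 1 n′ ⟩
      sumFrom 1 n′ (λ i → pow (w i) (suc A))                   ≈⟨ +-identityˡ _ ⟨
      0# + sumFrom 1 n′ (λ i → pow (w i) (suc A))              ≈⟨ +-cong w₀-term (sumFrom-cong 1 n′ (λ i → *-identityʳ _)) ⟨
      twisted (suc A) 0                                        ≈⟨ twisted-at-zero (suc A) (s≤s 1+A≤n′) ⟩
      ν                                                        ∎
      where
      w₀-term : pow (w 0) (suc A) * 1# ≈ 0#
      w₀-term = trans (*-identityʳ _) (trans (*-congʳ (-‿inverseʳ 1#)) (zeroˡ _))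

    open ConstantPowerSums ws ν n′ p-ws using (e-recurrence)

    e-ws : ∀ k → k ≤ n′ → e k ws ≈ N (n C k)
    e-ws zero          _       = sym (+-identityʳ 1#)
    e-ws (suc zero)    1≤n′    = begin
      e 1 ws      ≡⟨ p-one≡e-one ws ⟨
      p 1 ws      ≈⟨ p-ws 1 (s≤s z≤n) 1≤n′ ⟩
      ν           ≡⟨ P.cong N (nC1≡n n) ⟨
      N (n C 1)   ∎
    e-ws (suc (suc k)) 2+k≤n′  = *-cancelˡ (cz (suc k)) (begin
      N (suc (suc k)) * e (suc (suc k)) ws        ≈⟨ e-recurrence k 2+k≤n′ ⟩
      (ν - N (suc k)) * e (suc k) ws              ≈⟨ *-cong (sym (N-∸ 1+k≤n)) (e-ws (suc k) (ℕP.<⇒≤ 2+k≤n′)) ⟩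
      N (n ∸ suc k) * N (n C suc k)               ≈⟨ N-* (n ∸ suc k) (n C suc k) ⟨
      N ((n ∸ suc k) ℕ.* (n C suc k))             ≡⟨ P.cong N ([1+k]*nC[1+k]≡[n∸k]*nCk n (suc k)) ⟨
      N (suc (suc k) ℕ.* (n C suc (suc k)))       ≈⟨ N-* (suc (suc k)) (n C suc (suc k)) ⟩
      N (suc (suc k)) * N (n C suc (suc k))       ∎)
      where
      1+k≤n : suc k ≤ n
      1+k≤n = ℕP.≤-trans (ℕP.n≤1+n (suc k)) (ℕP.m≤n⇒m≤1+n 2+k≤n′)

    w≉0 : ∀ lo k → 1 ≤ lo → lo ℕ.+ k ≤ n → All (_≉ 0#) (values w lo k)
    w≉0 lo zero    _    _         = []
    w≉0 lo (suc k) 1≤lo lo+1+k≤n = w-lo≉0 ∷ w≉0 (suc lo) k (s≤s z≤n) 1+lo+k≤n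
      where
      1+lo+k≤n : suc lo ℕ.+ k ≤ n
      1+lo+k≤n = P.subst (_≤ n) (ℕP.+-suc lo k) lo+1+k≤n
      w-lo≉0 : w lo ≉ 0#
      w-lo≉0 wlo≈0 = proj₂ prim lo 1≤lo (ℕP.≤-trans (s≤s (ℕP.m≤m+n lo k)) 1+lo+k≤n) (sym (x-y≈0⇒x≈y _ _ wlo≈0))

    ws≉0 : All (_≉ 0#) ws
    ws≉0 = w≉0 1 n′ (s≤s z≤n) ℕP.≤-refl

    prod-ws : foldr _*_ 1# ws ≈ ν
    prod-ws = begin
      foldr _*_ 1# ws        ≈⟨ *-identityˡ _ ⟨
      1# * foldr _*_ 1# ws   ≈⟨ e-reciprocal ws ws≉0 0 n′ (P.sym (length-values w 1 n′)) ⟩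
      e n′ ws                ≈⟨ e-ws n′ ℕP.≤-refl ⟩
      N (n C n′)             ≡⟨ P.cong N nCn′≡n ⟩
      ν                      ∎
      where
      nCn′≡n : n C n′ ≡ n
      nCn′≡n = P.trans (nCk≡nC[n∸k] (ℕP.n≤1+n n′)) (P.trans (P.cong (n C_) (ℕP.m+n∸n≡m 1 n′)) (nC1≡n n))

    open Reciprocals n ζ using (xs)

    ν*e-xs : ∀ k → ν * e k xs ≈ N (n C suc k)
    ν*e-xs k with k ℕ.≤? n′
    ... | yes k≤n′ = begin
      ν * e k xs                           ≈⟨ *-comm ν _ ⟩
      e k xs * ν                           ≈⟨ *-congˡ prod-ws ⟨
      e k xs * foldr _*_ 1# ws             ≡⟨ P.cong (λ ys → e k ys * foldr _*_ 1# ws) (map-values _⁻¹ w 1 n′) ⟨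
      e k (map _⁻¹ ws) * foldr _*_ 1# ws   ≈⟨ e-reciprocal ws ws≉0 k (n′ ∸ k)
                                                (P.trans (ℕP.m+[n∸m]≡n k≤n′) (P.sym (length-values w 1 n′))) ⟩
      e (n′ ∸ k) ws                        ≈⟨ e-ws (n′ ∸ k) (ℕP.m∸n≤m n′ k) ⟩
      N (n C (n′ ∸ k))                     ≡⟨ P.cong N (nCk≡nC[n∸k] (ℕP.≤-trans (ℕP.m∸n≤m n′ k) (ℕP.n≤1+n n′))) ⟩
      N (n C (n ∸ (n′ ∸ k)))               ≡⟨ P.cong (λ j → N (n C j)) (P.trans (ℕP.+-∸-assoc 1 (ℕP.m∸n≤m n′ k))
                                                                            (P.cong suc (ℕP.m∸[m∸n]≡n k≤n′))) ⟩
      N (n C suc k)                        ∎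
    ... | no k≰n′ = begin
      ν * e k xs           ≈⟨ *-congˡ (e-over k xs (P.subst (ℕ._< k) (P.sym (length-values _ 1 n′)) (ℕP.≰⇒> k≰n′))) ⟩
      ν * 0#               ≈⟨ zeroʳ ν ⟩
      0#                   ≡⟨ P.cong N (k>n⇒nCk≡0 (s≤s (ℕP.≰⇒> k≰n′))) ⟨
      N (n C suc k)        ∎

    B≈N*e : ∀ k → B n k ≈ N (suc k) * e k xs
    B≈N*e k = *-cancelˡ (cz n′) (begin
      ν * N (n′ C k)               ≈⟨ N-* n (n′ C k) ⟨
      N (n ℕ.* (n′ C k))           ≡⟨ P.cong N ([1+k]*[1+n]C[1+k]≡[1+n]*nCk n′ k) ⟨
      N (suc k ℕ.* (n C suc k))    ≈⟨ N-* (suc k) (n C suc k) ⟩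
      N (suc k) * N (n C suc k)    ≈⟨ *-congˡ (ν*e-xs k) ⟨
      N (suc k) * (ν * e k xs)     ≈⟨ x∙yz≈y∙xz _ _ _ ⟩
      ν * (N (suc k) * e k xs)     ∎)

    e-suc : ∀ k → N (suc (suc k)) * e (suc k) xs ≈ I (+ n ℤ.- + k ℤ.- + 1) * e k xs
    e-suc k = *-cancelˡ (cz n′) (begin
      ν * (N (suc (suc k)) * e (suc k) xs)    ≈⟨ x∙yz≈y∙xz _ _ _ ⟩
      N (suc (suc k)) * (ν * e (suc k) xs)    ≈⟨ *-congˡ (ν*e-xs (suc k)) ⟩
      N (suc (suc k)) * N (n C suc (suc k))   ≈⟨ N-* (suc (suc k)) (n C suc (suc k)) ⟨
      N (suc (suc k) ℕ.* (n C suc (suc k)))   ≡⟨ P.cong N ([1+k]*nC[1+k]≡[n∸k]*nCk n (suc k)) ⟩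
      N ((n ∸ suc k) ℕ.* (n C suc k))         ≈⟨ N-* (n ∸ suc k) (n C suc k) ⟩
      N (n ∸ suc k) * N (n C suc k)           ≈⟨ truncated ⟩
      I a * N (n C suc k)                     ≈⟨ *-congˡ (ν*e-xs k) ⟨
      I a * (ν * e k xs)                      ≈⟨ x∙yz≈y∙xz _ _ _ ⟩
      ν * (I a * e k xs)                      ∎)
      where
      a : ℤ
      a = + n ℤ.- + k ℤ.- + 1
      -- ℕ-subtraction truncates, but past n the binomial factor vanishes anyway.
      truncated : N (n ∸ suc k) * N (n C suc k) ≈ I a * N (n C suc k)
      truncated with suc k ℕ.≤? n
      ... | yes 1+k≤n = *-congʳ (trans (N-∸ 1+k≤n) (sym (I[a-k-1]≈N[a]-N[1+k] n k)))
      ... | no 1+k≰n rewrite k>n⇒nCk≡0 (ℕP.≰⇒> 1+k≰n) = trans (zeroʳ _) (sym (zeroʳ _))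

  -- The closed forms

  module ClosedForms (cz : CharZero) (n′ : ℕ) (E : ℕ → Carrier)
                     (B≈N*E : ∀ k → B (suc n′) k ≈ N (suc k) * E k)
                     (E-suc : ∀ k → N (suc (suc k)) * E (suc k) ≈ I (+ suc n′ ℤ.- + k ℤ.- + 1) * E k) where

    n : ℕ
    n = suc n′

    -- R A m is the value claimed for S n ζ m A: R₁ m = m · eₘ, and R₂, …, R₅ are the
    -- right-hand sides of the theorem. In the integer identities `numerator` below, N and M
    -- stand for + n and + m, and + (2 ℕ.* m) is written in its unfolded form
    -- M ℤ.+ (M ℤ.+ + 0), so that the identities apply to the statement without rewriting.

    c : ℕ → ℤ
    c k = + n ℤ.- + k ℤ.- + 1

    σ : ℕ → ℤ
    σ k = (+ n ℤ.- + 1) ℤ.* (+ n ℤ.- + k)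

    a₂ a₃ a₄ a₅ : ℕ → ℤ
    a₂ m = + m ℤ.* (+ n ℤ.- + (2 ℕ.* m) ℤ.- + 3)
    a₃ m = + (m ℕ.+ 1) ℤ.* (+ n ℤ.- + (2 ℕ.* m) ℤ.- + 5) ℤ.* (+ n ℤ.- + m ℤ.- + 1)
    a₄ m = + (m ℕ.+ 2) ℤ.* (+ n ℤ.- + (2 ℕ.* m) ℤ.- + 7)
    a₅ m = + (m ℕ.+ 3) ℤ.* (+ n ℤ.- + (2 ℕ.* m) ℤ.- + 9)

    τ : ℤ
    τ = (+ n ℤ.- + 1) ℤ.* (+ (n ℕ.^ 3) ℤ.+ + (n ℕ.^ 2) ℤ.- + (109 ℕ.* n) ℤ.+ + 251)

    R₁ R₂ R₃ R₄ R₅ : ℕ → Carrier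
    R₁ m = N m * E m
    R₂ m = - (frac (a₂ m) (2 ℕ.* (m ℕ.+ 1) ℕ.* (m ℕ.+ 2)) * B n m)
    R₃ m = frac (+ 1) (m ℕ.+ 1) * B n m
             * (- frac (σ 5) 12 + frac (a₃ m) (2 ℕ.* (m ℕ.+ 2) ℕ.* (m ℕ.+ 3)))
    R₄ m = - (frac (σ 3) (8 ℕ.* (m ℕ.+ 1)) * B n m)
             + frac (σ 5) (12 ℕ.* (m ℕ.+ 2)) * B n (m ℕ.+ 1)
             - frac (a₄ m) (2 ℕ.* (m ℕ.+ 3) ℕ.* (m ℕ.+ 4)) * B n (m ℕ.+ 2)
    R₅ m = frac τ (720 ℕ.* (m ℕ.+ 1)) * B n m
             + frac (σ 3) (8 ℕ.* (m ℕ.+ 2)) * B n (m ℕ.+ 1)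
             - frac (σ 5) (12 ℕ.* (m ℕ.+ 3)) * B n (m ℕ.+ 2)
             + frac (a₅ m) (2 ℕ.* (m ℕ.+ 4) ℕ.* (m ℕ.+ 5)) * B n (m ℕ.+ 3)

    +suc≉0 : ∀ k j → N (k ℕ.+ suc j) ≉ 0#
    +suc≉0 k j = P.subst (λ d → N d ≉ 0#) (P.sym (ℕP.+-suc k j)) (cz (k ℕ.+ j))

    E-zero : E 0 ≈ 1#
    E-zero = *-cancelˡ (cz 0) (trans (sym (B≈N*E 0)) (sym (*-identityʳ (N 1))))

    E-frac : ∀ k → E (suc k) ≈ frac (c k) (suc (suc k)) * E k
    E-frac k = frac-intro (c k) (suc (suc k)) (cz (suc k)) (E-suc k)

    B-suc : ∀ k → B n (suc k) ≈ I (c k) * E k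
    B-suc k = trans (B≈N*E (suc k)) (E-suc k)

    B-rec : ∀ k → N (suc k) * B n (suc k) ≈ I (c k) * B n k
    B-rec k = begin
      N (suc k) * B n (suc k)       ≈⟨ *-congˡ (B-suc k) ⟩
      N (suc k) * (I (c k) * E k)   ≈⟨ x∙yz≈y∙xz _ _ _ ⟩
      I (c k) * (N (suc k) * E k)   ≈⟨ *-congˡ (B≈N*E k) ⟨
      I (c k) * B n k               ∎

    B≈N[k+1]*E : ∀ k → B n k ≈ N (k ℕ.+ 1) * E k
    B≈N[k+1]*E k = trans (B≈N*E k) (reflexive (P.cong (λ j → N j * E k) (ℕP.+-comm 1 k)))

    unit-frac*I*B≈B : ∀ k → frac (+ 1) (k ℕ.+ 1) * (I (c k) * B n k) ≈ B n (suc k)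
    unit-frac*I*B≈B k = begin
      frac (+ 1) (k ℕ.+ 1) * (I (c k) * B n k)               ≈⟨ *-congˡ (B-rec k) ⟨
      frac (+ 1) (k ℕ.+ 1) * (N (suc k) * B n (suc k))       ≡⟨ P.cong (λ j → frac (+ 1) (k ℕ.+ 1) * (N j * B n (suc k))) (ℕP.+-comm 1 k) ⟩
      frac (+ 1) (k ℕ.+ 1) * (N (k ℕ.+ 1) * B n (suc k))     ≈⟨ *-assoc _ _ _ ⟨
      frac (+ 1) (k ℕ.+ 1) * N (k ℕ.+ 1) * B n (suc k)       ≈⟨ *-congʳ (unit-frac*N≈1 (k ℕ.+ 1) (+suc≉0 k 0)) ⟩
      1# * B n (suc k)                                       ≈⟨ *-identityˡ _ ⟩
      B n (suc k)                                            ∎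

    frac*B≈frac*E : ∀ a d k → N d ≉ 0# → frac a (d ℕ.* (k ℕ.+ 1)) * B n k ≈ frac a d * E k
    frac*B≈frac*E a d k d≉0 = begin
      frac a (d ℕ.* (k ℕ.+ 1)) * B n k                 ≈⟨ *-congˡ (B≈N[k+1]*E k) ⟩
      frac a (d ℕ.* (k ℕ.+ 1)) * (N (k ℕ.+ 1) * E k)   ≈⟨ *-assoc _ _ _ ⟨
      frac a (d ℕ.* (k ℕ.+ 1)) * N (k ℕ.+ 1) * E k     ≈⟨ *-congʳ (frac*N≈frac a d (k ℕ.+ 1) d≉0 (+suc≉0 k 0)) ⟩
      frac a d * E k                                   ∎

    unit-frac*B≈E : ∀ k → frac (+ 1) (k ℕ.+ 1) * B n k ≈ E k
    unit-frac*B≈E k = begin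
      frac (+ 1) (k ℕ.+ 1) * B n k                  ≈⟨ *-congˡ (B≈N[k+1]*E k) ⟩
      frac (+ 1) (k ℕ.+ 1) * (N (k ℕ.+ 1) * E k)    ≈⟨ *-assoc _ _ _ ⟨
      frac (+ 1) (k ℕ.+ 1) * N (k ℕ.+ 1) * E k      ≈⟨ *-congʳ (unit-frac*N≈1 (k ℕ.+ 1) (+suc≉0 k 0)) ⟩
      1# * E k                                      ≈⟨ *-identityˡ (E k) ⟩
      E k                                           ∎

    R₂-step : ∀ m → R₁ 1 * E m - R₁ (suc m) ≈ R₂ m
    R₂-step m = begin
      N 1 * E 1 * E m - N (suc m) * E (suc m)
        ≈⟨ +-cong (*-congʳ N₁E₁≈) (-‿cong (*-congˡ (E-frac m))) ⟩
      frac (c 0) 2 * E m - N (suc m) * (frac (c m) (suc (suc m)) * E m)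
        ≈⟨ +-congˡ (-‿cong (trans (sym (*-assoc _ _ _)) (*-congʳ (trans (*-comm _ _) (frac*I≈frac (c m) (+ suc m) (suc (suc m))))))) ⟩
      frac (c 0) 2 * E m - frac (c m ℤ.* + suc m) (suc (suc m)) * E m
        ≈⟨ [y-z]x≈yx-zx (E m) _ _ ⟨
      (frac (c 0) 2 - frac (c m ℤ.* + suc m) (suc (suc m))) * E m
        ≈⟨ *-congʳ (trans (+-congˡ (-frac≈frac (c m ℤ.* + suc m) (suc (suc m))))
                          (frac+frac≈frac (c 0) (ℤ.- (c m ℤ.* + suc m)) 2 (suc (suc m)) (cz 1) (cz (suc m)))) ⟩
      frac (c 0 ℤ.* + suc (suc m) ℤ.+ ℤ.- (c m ℤ.* + suc m) ℤ.* + 2) (2 ℕ.* suc (suc m)) * E m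
        ≡⟨ P.cong₂ (λ a d → frac a d * E m) (numerator (+ n) (+ m)) (P.cong (2 ℕ.*_) (ℕP.+-comm 2 m)) ⟩
      frac (ℤ.- a₂ m) (2 ℕ.* (m ℕ.+ 2)) * E m
        ≈⟨ *-congʳ (-frac≈frac (a₂ m) (2 ℕ.* (m ℕ.+ 2))) ⟨
      - frac (a₂ m) (2 ℕ.* (m ℕ.+ 2)) * E m
        ≈⟨ -‿distribˡ-* _ _ ⟨
      - (frac (a₂ m) (2 ℕ.* (m ℕ.+ 2)) * E m)
        ≈⟨ -‿cong (frac*B≈frac*E (a₂ m) (2 ℕ.* (m ℕ.+ 2)) m (N-*-≉0 2 (m ℕ.+ 2) (cz 1) (+suc≉0 m 1))) ⟨
      - (frac (a₂ m) (2 ℕ.* (m ℕ.+ 2) ℕ.* (m ℕ.+ 1)) * B n m)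
        ≡⟨ P.cong (λ d → - (frac (a₂ m) d * B n m)) (ℕ-xy*z≡xz*y 2 (m ℕ.+ 2) (m ℕ.+ 1)) ⟩
      R₂ m ∎
      where
      numerator : ∀ N M → (N ℤ.- + 0 ℤ.- + 1) ℤ.* (+ 2 ℤ.+ M) ℤ.+ ℤ.- ((N ℤ.- M ℤ.- + 1) ℤ.* (+ 1 ℤ.+ M)) ℤ.* + 2
                          ≡ ℤ.- (M ℤ.* (N ℤ.- (M ℤ.+ (M ℤ.+ + 0)) ℤ.- + 3))
      numerator = solve-∀
      N₁E₁≈ : N 1 * E 1 ≈ frac (c 0) 2
      N₁E₁≈ = begin
        N 1 * E 1                  ≈⟨ *-cong (+-identityʳ 1#) (E-frac 0) ⟩
        1# * (frac (c 0) 2 * E 0)  ≈⟨ *-identityˡ _ ⟩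
        frac (c 0) 2 * E 0         ≈⟨ *-congˡ E-zero ⟩
        frac (c 0) 2 * 1#          ≈⟨ *-identityʳ _ ⟩
        frac (c 0) 2               ∎

    B-one : B n 1 ≈ I (c 0)
    B-one = trans (B-suc 0) (trans (*-congˡ E-zero) (*-identityʳ _))

    B-frac : ∀ k → B n (suc k) ≈ frac (c k) (suc k) * B n k
    B-frac k = frac-intro (c k) (suc k) (cz k) (B-rec k)

    B-two : B n 2 ≈ frac (c 1 ℤ.* c 0) 2
    B-two = trans (B-frac 1) (trans (*-congˡ B-one) (frac*I≈frac (c 1) (c 0) 2))

    B-three : B n 3 ≈ frac (c 2 ℤ.* (c 1 ℤ.* c 0)) 6
    B-three = trans (B-frac 2) (trans (*-congˡ B-two) (frac*frac≈frac (c 2) (c 1 ℤ.* c 0) 3 2 (cz 2) (cz 1)))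

    R₂-at-1 : R₂ 1 ≈ - frac (σ 5) 12
    R₂-at-1 = begin
      - (frac (a₂ 1) 12 * B n 1)       ≈⟨ -‿cong (*-congˡ B-one) ⟩
      - (frac (a₂ 1) 12 * I (c 0))     ≈⟨ -‿cong (frac*I≈frac (a₂ 1) (c 0) 12) ⟩
      - frac (a₂ 1 ℤ.* c 0) 12         ≡⟨ P.cong (λ a → - frac a 12) (numerator (+ n)) ⟩
      - frac (σ 5) 12                  ∎
      where
      numerator : ∀ N → + 1 ℤ.* (N ℤ.- + 2 ℤ.- + 3) ℤ.* (N ℤ.- + 0 ℤ.- + 1) ≡ (N ℤ.- + 1) ℤ.* (N ℤ.- + 5)
      numerator = solve-∀

    R₃-step : ∀ m → R₂ 1 * E m - R₂ (suc m) ≈ R₃ m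
    R₃-step m = begin
      R₂ 1 * E m - R₂ (suc m)                   ≈⟨ +-cong (*-congʳ R₂-at-1) (-‿cong (-‿cong shifted)) ⟩
      - g₁ * E m - - (g₂ * E m)                 ≈⟨ regroup g₁ g₂ (E m) ⟩
      E m * (- g₁ + g₂)                         ≈⟨ *-congʳ (unit-frac*B≈E m) ⟨
      R₃ m                                      ∎
      where
      numerator : ∀ N M → (+ 1 ℤ.+ M) ℤ.* (N ℤ.- ((+ 1 ℤ.+ M) ℤ.+ ((+ 1 ℤ.+ M) ℤ.+ + 0)) ℤ.- + 3) ℤ.* (N ℤ.- M ℤ.- + 1)
                          ≡ (M ℤ.+ + 1) ℤ.* (N ℤ.- (M ℤ.+ (M ℤ.+ + 0)) ℤ.- + 5) ℤ.* (N ℤ.- M ℤ.- + 1)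
      numerator = solve-∀
      g₁ g₂ h : Carrier
      g₁ = frac (σ 5) 12
      g₂ = frac (a₃ m) (2 ℕ.* (m ℕ.+ 2) ℕ.* (m ℕ.+ 3))
      h  = frac (a₂ (suc m)) (2 ℕ.* (suc m ℕ.+ 1) ℕ.* (suc m ℕ.+ 2))
      shifted : h * B n (suc m) ≈ g₂ * E m
      shifted = begin
        h * B n (suc m)                                                        ≈⟨ *-congˡ (B-suc m) ⟩
        h * (I (c m) * E m)                                                    ≈⟨ *-assoc _ _ _ ⟨
        h * I (c m) * E m                                                      ≈⟨ *-congʳ (frac*I≈frac (a₂ (suc m)) (c m) (2 ℕ.* (suc m ℕ.+ 1) ℕ.* (suc m ℕ.+ 2))) ⟩
        frac (a₂ (suc m) ℤ.* c m) (2 ℕ.* (suc m ℕ.+ 1) ℕ.* (suc m ℕ.+ 2)) * E m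
          ≡⟨ P.cong₂ (λ a d → frac a d * E m) (numerator (+ n) (+ m))
                     (P.cong₂ (λ x y → 2 ℕ.* x ℕ.* y) (P.sym (ℕP.+-suc m 1)) (P.sym (ℕP.+-suc m 2))) ⟩
        g₂ * E m                                                               ∎
      regroup : ∀ x y z → - x * z - - (y * z) ≈ z * (- x + y)
      regroup = solve 3 (λ x y z → :- x :* z :- :- (y :* z) := z :* (:- x :+ y)) refl

    R₃-at-1 : R₃ 1 ≈ - frac (σ 3) 8
    R₃-at-1 = begin
      frac (+ 1) 2 * B n 1 * (- frac (σ 5) 12 + frac (a₃ 1) 24)
        ≈⟨ *-cong (*-congˡ B-one) (+-congʳ (-frac≈frac (σ 5) 12)) ⟩
      frac (+ 1) 2 * I (c 0) * (frac (ℤ.- σ 5) 12 + frac (a₃ 1) 24)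
        ≈⟨ *-cong (frac*I≈frac (+ 1) (c 0) 2) (frac+frac≈frac (ℤ.- σ 5) (a₃ 1) 12 24 (cz 11) (cz 23)) ⟩
      frac (+ 1 ℤ.* c 0) 2 * frac (ℤ.- σ 5 ℤ.* + 24 ℤ.+ a₃ 1 ℤ.* + 12) 288
        ≈⟨ frac*frac≈frac (+ 1 ℤ.* c 0) (ℤ.- σ 5 ℤ.* + 24 ℤ.+ a₃ 1 ℤ.* + 12) 2 288 (cz 1) (cz 287) ⟩
      frac (+ 1 ℤ.* c 0 ℤ.* (ℤ.- σ 5 ℤ.* + 24 ℤ.+ a₃ 1 ℤ.* + 12)) 576
        ≈⟨ frac-cross (+ 1 ℤ.* c 0 ℤ.* (ℤ.- σ 5 ℤ.* + 24 ℤ.+ a₃ 1 ℤ.* + 12)) (ℤ.- σ 3) 576 8 (cz 575) (cz 7) (numerator (+ n)) ⟩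
      frac (ℤ.- σ 3) 8
        ≈⟨ -frac≈frac (σ 3) 8 ⟨
      - frac (σ 3) 8
        ∎
      where
      numerator : ∀ N → + 1 ℤ.* (N ℤ.- + 0 ℤ.- + 1)
                          ℤ.* (ℤ.- ((N ℤ.- + 1) ℤ.* (N ℤ.- + 5)) ℤ.* + 24
                               ℤ.+ + 2 ℤ.* (N ℤ.- + 2 ℤ.- + 5) ℤ.* (N ℤ.- + 1 ℤ.- + 1) ℤ.* + 12) ℤ.* + 8
                        ≡ ℤ.- ((N ℤ.- + 1) ℤ.* (N ℤ.- + 3)) ℤ.* + 576
      numerator = solve-∀

    R₄-step : ∀ m → R₃ 1 * E m - R₃ (suc m) ≈ R₄ m
    R₄-step m = begin
      R₃ 1 * E m - u * (- g₁ + g₂)                ≈⟨ regroup (R₃ 1 * E m) u g₁ g₂ ⟩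
      R₃ 1 * E m + u * g₁ - u * g₂                ≈⟨ +-cong (+-cong leading middle) (-‿cong last) ⟩
      R₄ m                                        ∎
      where
      numerator : ∀ N M → (+ 1 ℤ.+ M ℤ.+ + 1) ℤ.* (N ℤ.- ((+ 1 ℤ.+ M) ℤ.+ ((+ 1 ℤ.+ M) ℤ.+ + 0)) ℤ.- + 5)
                            ℤ.* (N ℤ.- (+ 1 ℤ.+ M) ℤ.- + 1)
                          ≡ (M ℤ.+ + 2) ℤ.* (N ℤ.- (M ℤ.+ (M ℤ.+ + 0)) ℤ.- + 7) ℤ.* (N ℤ.- (+ 1 ℤ.+ M) ℤ.- + 1)
      numerator = solve-∀
      d : ℕ
      d = suc m ℕ.+ 1
      u g₁ g₂ : Carrier
      u  = frac (+ 1) d * B n (suc m)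
      g₁ = frac (σ 5) 12
      g₂ = frac (a₃ (suc m)) (2 ℕ.* (suc m ℕ.+ 2) ℕ.* (suc m ℕ.+ 3))
      regroup : ∀ x u y z → x - u * (- y + z) ≈ x + u * y - u * z
      regroup = solve 4 (λ x u y z → x :- u :* (:- y :+ z) := x :+ u :* y :- u :* z) refl
      leading : R₃ 1 * E m ≈ - (frac (σ 3) (8 ℕ.* (m ℕ.+ 1)) * B n m)
      leading = begin
        R₃ 1 * E m                                 ≈⟨ *-congʳ R₃-at-1 ⟩
        - frac (σ 3) 8 * E m                       ≈⟨ -‿distribˡ-* _ _ ⟨
        - (frac (σ 3) 8 * E m)                     ≈⟨ -‿cong (frac*B≈frac*E (σ 3) 8 m (cz 7)) ⟨
        - (frac (σ 3) (8 ℕ.* (m ℕ.+ 1)) * B n m)   ∎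
      middle : u * g₁ ≈ frac (σ 5) (12 ℕ.* (m ℕ.+ 2)) * B n (m ℕ.+ 1)
      middle = begin
        frac (+ 1) d * B n (suc m) * g₁          ≈⟨ xy∙z≈xz∙y (frac (+ 1) d) (B n (suc m)) g₁ ⟩
        frac (+ 1) d * g₁ * B n (suc m)          ≈⟨ *-congʳ (frac*frac≈frac (+ 1) (σ 5) d 12 (+suc≉0 (suc m) 0) (cz 11)) ⟩
        frac (+ 1 ℤ.* σ 5) (d ℕ.* 12) * B n (suc m)
          ≡⟨ P.cong₂ (λ a k → frac a k * B n (suc m)) (ℤP.*-identityˡ (σ 5))
                     (P.trans (ℕP.*-comm d 12) (P.cong (12 ℕ.*_) (P.sym (ℕP.+-suc m 1)))) ⟩
        frac (σ 5) (12 ℕ.* (m ℕ.+ 2)) * B n (suc m)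
          ≡⟨ P.cong (λ j → frac (σ 5) (12 ℕ.* (m ℕ.+ 2)) * B n j) (ℕP.+-comm 1 m) ⟩
        frac (σ 5) (12 ℕ.* (m ℕ.+ 2)) * B n (m ℕ.+ 1) ∎
      last : u * g₂ ≈ frac (a₄ m) (2 ℕ.* (m ℕ.+ 3) ℕ.* (m ℕ.+ 4)) * B n (m ℕ.+ 2)
      last = begin
        u * g₂
          ≡⟨ P.cong₂ (λ a k → u * frac a k) (numerator (+ n) (+ m))
                     (P.cong₂ (λ x y → 2 ℕ.* x ℕ.* y) (P.sym (ℕP.+-suc m 2)) (P.sym (ℕP.+-suc m 3))) ⟩
        u * frac (a₄ m ℤ.* c (suc m)) D
          ≈⟨ *-congˡ (frac*I≈frac (a₄ m) (c (suc m)) D) ⟨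
        frac (+ 1) d * B n (suc m) * (frac (a₄ m) D * I (c (suc m)))
          ≈⟨ rearrange (frac (+ 1) d) (B n (suc m)) (frac (a₄ m) D) (I (c (suc m))) ⟩
        frac (a₄ m) D * (frac (+ 1) d * (I (c (suc m)) * B n (suc m)))
          ≈⟨ *-congˡ (unit-frac*I*B≈B (suc m)) ⟩
        frac (a₄ m) D * B n (suc (suc m))
          ≡⟨ P.cong (λ j → frac (a₄ m) D * B n j) (ℕP.+-comm 2 m) ⟩
        frac (a₄ m) D * B n (m ℕ.+ 2) ∎
        where
        D : ℕ
        D = 2 ℕ.* (m ℕ.+ 3) ℕ.* (m ℕ.+ 4)
        rearrange : ∀ f b g i → f * b * (g * i) ≈ g * (f * (i * b))
        rearrange = solve 4 (λ f b g i → f :* b :* (g :* i) := g :* (f :* (i :* b))) refl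

    R₄-at-1 : R₄ 1 ≈ frac τ 720
    R₄-at-1 = begin
      - (frac (σ 3) 16 * B n 1) + frac (σ 5) 36 * B n 2 - frac (a₄ 1) 40 * B n 3
        ≈⟨ +-cong (+-cong (-‿cong t₁) t₂) (-‿cong t₃) ⟩
      - frac x₁ 16 + frac x₂ 72 - frac x₃ 240
        ≈⟨ +-cong (+-congʳ (-frac≈frac x₁ 16)) (-frac≈frac x₃ 240) ⟩
      frac (ℤ.- x₁) 16 + frac x₂ 72 + frac (ℤ.- x₃) 240
        ≈⟨ +-congʳ (frac+frac≈frac (ℤ.- x₁) x₂ 16 72 (cz 15) (cz 71)) ⟩
      frac y 1152 + frac (ℤ.- x₃) 240
        ≈⟨ frac+frac≈frac y (ℤ.- x₃) 1152 240 (cz 1151) (cz 239) ⟩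
      frac z 276480
        ≈⟨ frac-cross z τ 276480 720 (cz 276479) (cz 719)
                      (P.trans (numerator (+ n)) (P.cong (λ q → (+ n ℤ.- + 1) ℤ.* q ℤ.* + 276480) (P.sym cubic≡))) ⟩
      frac τ 720
        ∎
      where
      numerator : ∀ N → ((ℤ.- ((N ℤ.- + 1) ℤ.* (N ℤ.- + 3) ℤ.* (N ℤ.- + 0 ℤ.- + 1)) ℤ.* + 72
                           ℤ.+ (N ℤ.- + 1) ℤ.* (N ℤ.- + 5) ℤ.* ((N ℤ.- + 1 ℤ.- + 1) ℤ.* (N ℤ.- + 0 ℤ.- + 1)) ℤ.* + 16)
                          ℤ.* + 240
                          ℤ.+ ℤ.- (+ 3 ℤ.* (N ℤ.- + 2 ℤ.- + 7)
                                   ℤ.* ((N ℤ.- + 2 ℤ.- + 1) ℤ.* ((N ℤ.- + 1 ℤ.- + 1) ℤ.* (N ℤ.- + 0 ℤ.- + 1))))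
                            ℤ.* + 1152) ℤ.* + 720
                        ≡ (N ℤ.- + 1) ℤ.* (N ℤ.* (N ℤ.* (N ℤ.* + 1)) ℤ.+ N ℤ.* (N ℤ.* + 1) ℤ.- + 109 ℤ.* N ℤ.+ + 251)
                          ℤ.* + 276480
      numerator = solve-∀
      cubic≡ : + (n ℕ.^ 3) ℤ.+ + (n ℕ.^ 2) ℤ.- + (109 ℕ.* n) ℤ.+ + 251
               ≡ + n ℤ.* (+ n ℤ.* (+ n ℤ.* + 1)) ℤ.+ + n ℤ.* (+ n ℤ.* + 1) ℤ.- + 109 ℤ.* + n ℤ.+ + 251
      cubic≡ = P.trans (P.cong₂ (λ x y → x ℤ.+ y ℤ.- + (109 ℕ.* n) ℤ.+ + 251) (pos-^ n 3) (pos-^ n 2))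
                       (P.cong (λ z → (+ n) ℤ.^ 3 ℤ.+ (+ n) ℤ.^ 2 ℤ.- z ℤ.+ + 251) (ℤP.pos-* 109 n))
      x₁ x₂ x₃ y z : ℤ
      x₁ = σ 3 ℤ.* c 0
      x₂ = σ 5 ℤ.* (c 1 ℤ.* c 0)
      x₃ = a₄ 1 ℤ.* (c 2 ℤ.* (c 1 ℤ.* c 0))
      y  = ℤ.- x₁ ℤ.* + 72 ℤ.+ x₂ ℤ.* + 16
      z  = y ℤ.* + 240 ℤ.+ ℤ.- x₃ ℤ.* + 1152
      t₁ : frac (σ 3) 16 * B n 1 ≈ frac x₁ 16
      t₁ = trans (*-congˡ B-one) (frac*I≈frac (σ 3) (c 0) 16)
      t₂ : frac (σ 5) 36 * B n 2 ≈ frac x₂ 72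
      t₂ = trans (*-congˡ B-two) (frac*frac≈frac (σ 5) (c 1 ℤ.* c 0) 36 2 (cz 35) (cz 1))
      t₃ : frac (a₄ 1) 40 * B n 3 ≈ frac x₃ 240
      t₃ = trans (*-congˡ B-three) (frac*frac≈frac (a₄ 1) (c 2 ℤ.* (c 1 ℤ.* c 0)) 40 6 (cz 39) (cz 5))

    R₅-step : ∀ m → R₄ 1 * E m - R₄ (suc m) ≈ R₅ m
    R₅-step m = begin
      R₄ 1 * E m - R₄ (suc m)              ≡⟨ P.cong (λ r → R₄ 1 * E m - r) R₄-shift ⟩
      R₄ 1 * E m - (- y₁ + y₂ - y₃)        ≈⟨ regroup (R₄ 1 * E m) y₁ y₂ y₃ ⟩
      R₄ 1 * E m + y₁ - y₂ + y₃            ≈⟨ +-congʳ (+-congʳ (+-congʳ leading)) ⟩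
      R₅ m                                 ∎
      where
      numerator : ∀ N M → (+ 1 ℤ.+ M ℤ.+ + 2) ℤ.* (N ℤ.- ((+ 1 ℤ.+ M) ℤ.+ ((+ 1 ℤ.+ M) ℤ.+ + 0)) ℤ.- + 7)
                          ≡ (M ℤ.+ + 3) ℤ.* (N ℤ.- (M ℤ.+ (M ℤ.+ + 0)) ℤ.- + 9)
      numerator = solve-∀
      y₁ y₂ y₃ : Carrier
      y₁ = frac (σ 3) (8 ℕ.* (m ℕ.+ 2)) * B n (m ℕ.+ 1)
      y₂ = frac (σ 5) (12 ℕ.* (m ℕ.+ 3)) * B n (m ℕ.+ 2)
      y₃ = frac (a₅ m) (2 ℕ.* (m ℕ.+ 4) ℕ.* (m ℕ.+ 5)) * B n (m ℕ.+ 3)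
      R₄-shift : R₄ (suc m) ≡ - y₁ + y₂ - y₃
      R₄-shift = P.cong₂ _-_ (P.cong₂ _+_ (P.cong -_ shift₁) shift₂) shift₃
        where
        shift₁ : frac (σ 3) (8 ℕ.* (suc m ℕ.+ 1)) * B n (suc m) ≡ y₁
        shift₁ = P.cong₂ _*_ (P.cong (λ k → frac (σ 3) (8 ℕ.* k)) (P.sym (ℕP.+-suc m 1))) (P.cong (B n) (ℕP.+-comm 1 m))
        shift₂ : frac (σ 5) (12 ℕ.* (suc m ℕ.+ 2)) * B n (suc m ℕ.+ 1) ≡ y₂
        shift₂ = P.cong₂ _*_ (P.cong (λ k → frac (σ 5) (12 ℕ.* k)) (P.sym (ℕP.+-suc m 2))) (P.cong (B n) (P.sym (ℕP.+-suc m 1)))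
        shift₃ : frac (a₄ (suc m)) (2 ℕ.* (suc m ℕ.+ 3) ℕ.* (suc m ℕ.+ 4)) * B n (suc m ℕ.+ 2) ≡ y₃
        shift₃ = P.cong₂ _*_ (P.cong₂ frac (numerator (+ n) (+ m))
                                          (P.cong₂ (λ k j → 2 ℕ.* k ℕ.* j) (P.sym (ℕP.+-suc m 3)) (P.sym (ℕP.+-suc m 4))))
                             (P.cong (B n) (P.sym (ℕP.+-suc m 2)))
      leading : R₄ 1 * E m ≈ frac τ (720 ℕ.* (m ℕ.+ 1)) * B n m
      leading = trans (*-congʳ R₄-at-1) (sym (frac*B≈frac*E τ 720 m (cz 719)))
      regroup : ∀ x y₁ y₂ y₃ → x - (- y₁ + y₂ - y₃) ≈ x + y₁ - y₂ + y₃
      regroup = solve 4 (λ x y₁ y₂ y₃ → x :- (:- y₁ :+ y₂ :- y₃) := x :+ y₁ :- y₂ :+ y₃) refl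


open import Data.Product using (_,_)
open import Data.Nat using (suc; s≤s; z≤n)

theorem1 : {c ℓ : Level} (F : Field c ℓ) → let open Field F in let open FieldOps F in
    CharZero → (n m : ℕ) → 1 ≤ n → 1 ≤ m → (ζ : Carrier) → IsPrimitiveRoot n ζ →
    (S n ζ m 2 ≈ - (frac (+ m ℤ.* (+ n ℤ.- + (2 ℕ.* m) ℤ.- + 3)) (2 ℕ.* (m ℕ.+ 1) ℕ.* (m ℕ.+ 2)) * B n m))
    × (S n ζ m 3 ≈ frac (+ 1) (m ℕ.+ 1) * B n m
         * (- frac ((+ n ℤ.- + 1) ℤ.* (+ n ℤ.- + 5)) 12
            + frac (+ (m ℕ.+ 1) ℤ.* (+ n ℤ.- + (2 ℕ.* m) ℤ.- + 5) ℤ.* (+ n ℤ.- + m ℤ.- + 1))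
                   (2 ℕ.* (m ℕ.+ 2) ℕ.* (m ℕ.+ 3))))
    × (S n ζ m 4 ≈ - (frac ((+ n ℤ.- + 1) ℤ.* (+ n ℤ.- + 3)) (8 ℕ.* (m ℕ.+ 1)) * B n m)
         + frac ((+ n ℤ.- + 1) ℤ.* (+ n ℤ.- + 5)) (12 ℕ.* (m ℕ.+ 2)) * B n (m ℕ.+ 1)
         - frac (+ (m ℕ.+ 2) ℤ.* (+ n ℤ.- + (2 ℕ.* m) ℤ.- + 7)) (2 ℕ.* (m ℕ.+ 3) ℕ.* (m ℕ.+ 4)) * B n (m ℕ.+ 2))
    × (S n ζ m 5 ≈ frac ((+ n ℤ.- + 1) ℤ.* (+ (n ℕ.^ 3) ℤ.+ + (n ℕ.^ 2) ℤ.- + (109 ℕ.* n) ℤ.+ + 251))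
                        (720 ℕ.* (m ℕ.+ 1)) * B n m
         + frac ((+ n ℤ.- + 1) ℤ.* (+ n ℤ.- + 3)) (8 ℕ.* (m ℕ.+ 2)) * B n (m ℕ.+ 1)
         - frac ((+ n ℤ.- + 1) ℤ.* (+ n ℤ.- + 5)) (12 ℕ.* (m ℕ.+ 3)) * B n (m ℕ.+ 2)
         + frac (+ (m ℕ.+ 3) ℤ.* (+ n ℤ.- + (2 ℕ.* m) ℤ.- + 9)) (2 ℕ.* (m ℕ.+ 4) ℕ.* (m ℕ.+ 5)) * B n (m ℕ.+ 3))
theorem1 F cz (suc n′) (suc K) (s≤s z≤n) (s≤s z≤n) ζ prim = T₂ K , T₃ K , T₄ K , T₅ K
  where
  open Field F using (_≈_)
  open FieldOps F using (S)
  open RootsOfUnity F cz n′ ζ prim using (B≈N*e; e-suc)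
  open Reciprocals F (suc n′) ζ using (xs; S-one; S-closed-form-suc)
  open ClosedForms F cz n′ (λ k → e F k xs) B≈N*e e-suc
  T₂ : ∀ K → S (suc n′) ζ (suc K) 2 ≈ R₂ (suc K)
  T₂ = S-closed-form-suc 1 R₁ R₂ S-one R₂-step
  T₃ : ∀ K → S (suc n′) ζ (suc K) 3 ≈ R₃ (suc K)
  T₃ = S-closed-form-suc 2 R₂ R₃ T₂ R₃-step
  T₄ : ∀ K → S (suc n′) ζ (suc K) 4 ≈ R₄ (suc K)
  T₄ = S-closed-form-suc 3 R₃ R₄ T₃ R₄-step
  T₅ : ∀ K → S (suc n′) ζ (suc K) 5 ≈ R₅ (suc K)
  T₅ = S-closed-form-suc 4 R₄ R₅ T₄ R₅-step
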